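{- For every composition $\alpha$, the dual immaculate function expands in the monomial quasisymmetric basis as \[ \mathfrak{S}^*_\alpha = \sum_{\beta \leq_\ell \alpha} K_{\alpha,\beta} M_\beta, \] the sum over compositions $\beta$ with $|\beta|=|\alpha|$ that are lexicographically at most $\alpha$.
   Context: $\mathrm{NSym}$ is the free associative algebra over $\mathbb{Q}$ on $H_1,H_2,\dots$ ($H_0=1$, $H_{ -r}=0$ for $r>0$), graded dual to $\mathrm{QSym}$ through $\langle H_{\alpha_1}\cdots H_{\alpha_k},M_\beta\rangle=\delta_{\alpha\beta}$, $M_\beta$ the monomial quasisymmetric functions; coproduct $\Delta(H_j)=\sum_i H_i\otimes H_{j-i}$. For $F\in\mathrm{QSym}$, $F^\perp$ is given by $\langle F^\perp(H),G\rangle=\langle H,FG\rangle$, and $F_{1^i}=M_{1^i}$. Let $\mathbb{B}_m=\sum_{i\ge0}(-1)^iH_{m+i}F_{1^i}^\perp$ and $\mathfrak{S}_\alpha=\mathbb{B}_{\alpha_1}\cdots\mathbb{B}_{\alpha_m}(1)$; the $\mathfrak{S}_\alpha$ with $\alpha\models n$ form a basis of $\mathrm{NSym}_n$, and $\{\mathfrak{S}^*_\alpha\}$ is the dual basis of $\mathrm{QSym}$: $\langle\mathfrak{S}_\alpha,\mathfrak{S}^*_\beta\rangle=\delta_{\alpha\beta}$. An immaculate tableau of shape $\alpha$ and content $\beta$ (both compositions) is a filling of the diagram of $\alpha$ (left-justified rows, row $i$ having $\alpha_i$ cells, row 1 on top) with positive integers such that exactly $\beta_i$ cells contain $i$, each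 row weakly increases left to right, and the first column strictly increases top to bottom (no other column conditions). $K_{\alpha,\beta}$ is the number of such tableaux. $\leq_\ell$ is lexicographic order on compositions. -}

module Defs where

open import Data.Nat using (ℕ; zero; suc; _+_; _∸_; _<_; _≤ᵇ_; _<ᵇ_; _≡ᵇ_)
open import Data.Bool using (Bool; true; false; _∧_; _∨_; not; if_then_else_)
open import Data.List using (List; []; _∷_; map; concatMap; replicate; upTo; length; foldr)
open import Data.Nat.ListAction using (sum)
open import Data.List.Relation.Unary.All using (All)
open import Data.Product using (_×_; _,_)
open import Data.Integer using (+_)
open import Data.Rational using (ℚ; 0ℚ; 1ℚ; -_; _/_) renaming (_+_ to _+ℚ_; _*_ to _*ℚ_)
open import Relation.Binary.PropositionalEquality using (_≡_)

-- Words in ℕ index products H_{w1} H_{w2} ⋯ ; letters 0 stand for H_0 = 1.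
Word : Set
Word = List ℕ

_==w_ : Word → Word → Bool
[] ==w [] = true
[] ==w (_ ∷ _) = false
(_ ∷ _) ==w [] = false
(x ∷ xs) ==w (y ∷ ys) = (x ≡ᵇ y) ∧ (xs ==w ys)

strip : Word → Word
strip [] = []
strip (zero ∷ w) = strip w
strip (suc k ∷ w) = suc k ∷ strip w

IsComposition : ℕ → List ℕ → Set
IsComposition n α = All (λ k → 0 < k) α × sum α ≡ n

ℕ→ℚ : ℕ → ℚ
ℕ→ℚ n = + n / 1

-- NSym: an element is a formal ℚ-linear combination of words H_w
-- (coordinates in the H-basis H_α, after stripping zeros).
NSym : Set
NSym = List (ℚ × Word)

-- QSym element given by its coefficients in the monomial basis M_β
QSym : Set
QSym = Word → ℚ

-- the pairing ⟨H_α , M_β⟩ = δ_{αβ}, extended bilinearly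
pair : NSym → QSym → ℚ
pair [] G = 0ℚ
pair ((c , w) ∷ X) G = (c *ℚ G (strip w)) +ℚ pair X G

scale : ℚ → NSym → NSym
scale q = map (λ { (c , w) → (q *ℚ c , w) })

Hmul : ℕ → NSym → NSym
Hmul k = map (λ { (c , w) → (c , k ∷ w) })

-- coproduct of H_w: Δ(H_j) = Σ_{i=0}^{j} H_i ⊗ H_{j-i}, multiplicatively
cop : Word → List (Word × Word)
cop [] = ([] , []) ∷ []
cop (k ∷ w) = concatMap (λ i → map (λ { (a , b) → (i ∷ a , (k ∸ i) ∷ b) }) (cop w)) (upTo (suc k))

-- F^⊥ , characterised by ⟨F^⊥ H , G⟩ = ⟨H , F G⟩ = Σ ⟨H_(1),F⟩ ⟨H_(2),G⟩
perp : QSym → NSym → NSym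
perp F = concatMap (λ { (c , w) → map (λ { (a , b) → (c *ℚ F (strip a) , b) }) (cop w) })

-- F_{1^i} = M_{1^i}
F1 : ℕ → QSym
F1 i β = if β ==w replicate i 1 then 1ℚ else 0ℚ

-- total degree bound of an element (F_{1^i}^⊥ X = 0 for i > deg X)
deg : NSym → ℕ
deg = foldr (λ { (c , w) acc → sum w + acc }) 0

signℚ : ℕ → ℚ
signℚ zero = 1ℚ
signℚ (suc i) = - signℚ i

-- 𝔹_m = Σ_{i ≥ 0} (-1)^i H_{m+i} F_{1^i}^⊥   (terms with i > deg X vanish)
𝔹 : ℕ → NSym → NSym
𝔹 m X = concatMap (λ i → scale (signℚ i) (Hmul (m + i) (perp (F1 i) X))) (upTo (suc (deg X)))

𝔖 : List ℕ → NSym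
𝔖 [] = (1ℚ , []) ∷ []
𝔖 (a ∷ α) = 𝔹 a (𝔖 α)

rowsOf : ℕ → ℕ → List (List ℕ)
rowsOf zero m = [] ∷ []
rowsOf (suc k) m = concatMap (λ x → map (x ∷_) (rowsOf k m)) (map suc (upTo m))

fillings : List ℕ → ℕ → List (List (List ℕ))
fillings [] m = [] ∷ []
fillings (a ∷ α) m = concatMap (λ r → map (r ∷_) (fillings α m)) (rowsOf a m)

weakIncr : List ℕ → Bool
weakIncr [] = true
weakIncr (x ∷ []) = true
weakIncr (x ∷ y ∷ xs) = (x ≤ᵇ y) ∧ weakIncr (y ∷ xs)

strictIncr : List ℕ → Bool
strictIncr [] = true
strictIncr (x ∷ []) = true
strictIncr (x ∷ y ∷ xs) = (x <ᵇ y) ∧ strictIncr (y ∷ xs)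

allB : {A : Set} → (A → Bool) → List A → Bool
allB p [] = true
allB p (x ∷ xs) = p x ∧ allB p xs

firstColumn : List (List ℕ) → List ℕ
firstColumn [] = []
firstColumn ([] ∷ T) = firstColumn T
firstColumn ((x ∷ _) ∷ T) = x ∷ firstColumn T

count : ℕ → List ℕ → ℕ
count i [] = 0
count i (x ∷ xs) = if i ≡ᵇ x then suc (count i xs) else count i xs

contentOK : ℕ → List ℕ → List ℕ → Bool
contentOK i es [] = true
contentOK i es (b ∷ β) = (count i es ≡ᵇ b) ∧ contentOK (suc i) es β

flatten : List (List ℕ) → List ℕ
flatten = foldr (λ r acc → Data.List._++_ r acc) []

isImmaculate : List ℕ → List (List ℕ) → Bool
isImmaculate β T = allB weakIncr T ∧ strictIncr (firstColumn T) ∧ contentOK 1 (flatten T) β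

K : List ℕ → List ℕ → ℕ
K α β = sum (map (λ T → if isImmaculate β T then 1 else 0) (fillings α (length β)))

_≤ℓ_ : Word → Word → Bool
[] ≤ℓ _ = true
(x ∷ xs) ≤ℓ [] = false
(x ∷ xs) ≤ℓ (y ∷ ys) = (x <ᵇ y) ∨ ((x ≡ᵇ y) ∧ (xs ≤ℓ ys))

isCompB : Word → Bool
isCompB = allB (λ k → 1 ≤ᵇ k)

-- the right-hand side  Σ_{β ⊨ |α|, β ≤_ℓ α} K_{α,β} M_β , as M-coefficients
rhs : List ℕ → QSym
rhs α β = if isCompB β ∧ (sum β ≡ᵇ sum α) ∧ (β ≤ℓ α) then ℕ→ℚ (K α β) else 0ℚ

δ : List ℕ → List ℕ → ℚ
δ α γ = if α ==w γ then 1ℚ else 0ℚ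

-- 𝔖_γ = 𝔹_{γ₁}(𝔖_{γ′}), and moving 𝔹_{γ₁} across the pairing turns it into the alternating
-- sum Σ_i (-1)^i ⟨F_{1^i}, ·⟩ over the coproduct, which only sees 0/1-words a, with sign (-1)^|a|.
-- On the tableau side, an immaculate tableau of shape (A, α′) and content (p, b), p > 0, has all
-- its ones at the start of the first row (rows weakly increase, the first column strictly
-- increases), so K_{(A,α′),(p,b)} = [p ≤ A] Σ K_{α′, b − c}, the sum over the contents c ≤ b,
-- |c| = A − p, of the rest of the first row. In the alternating sum the words beginning with a 1
-- cancel exactly the terms in which c takes cells from the first part, so only [A = γ₁] times
-- the pairing for α′ and γ′ survives, and induction gives δ_{α,γ}. Two facts let the words and
-- the truncation β ≤ℓ α be ignored: K_{α,β} is unchanged by inserting zero parts into β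
-- (relabel the entries), and K_{α,β} ≠ 0 forces |β| = |α| and β ≤ℓ α.

module Submission where

open import Defs
open import Data.Nat using (ℕ)
open import Data.List using (List)
open import Relation.Binary.PropositionalEquality using (_≡_)

open import Algebra.Core using (Op₂)
open import Algebra.Structures using (IsCommutativeSemiring; IsCommutativeRing)
open import Data.Bool using (Bool; true; false; T; _∧_; _∨_; if_then_else_)
import Data.Bool.Properties as Boolₚ
open import Data.Empty using (⊥-elim)
open import Data.List using ([]; _∷_; map; concatMap; replicate; upTo; length; _++_)
import Data.List.Properties as Listₚ
open import Data.List.Relation.Unary.All as All using (All; []; _∷_)
import Data.List.Relation.Unary.All.Properties as Allₚ
open import Data.Nat using (zero; suc; pred; _∸_; _≤_; _<_; s≤s; z≤n; _≤ᵇ_; _<ᵇ_; _≡ᵇ_)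
open import Data.Nat.ListAction using (sum)
import Data.Nat.Properties as ℕₚ
open import Data.Nat.Tactic.RingSolver using (solve-∀)
open import Data.Product using (Σ; _×_; _,_; proj₁; proj₂)
open import Data.Rational using (ℚ; 0ℚ; 1ℚ)
import Data.Rational.Properties as ℚₚ
open import Function using (_∘_)
open import Function.Bundles using (Equivalence)
open import Relation.Binary.PropositionalEquality
  using (_≢_; refl; sym; trans; cong; cong₂; subst; module ≡-Reasoning)

open Equivalence using (to; from)

upTo-suc : ∀ n → upTo (suc n) ≡ 0 ∷ map suc (upTo n)
upTo-suc n = cong (0 ∷_) (sym (Listₚ.map-upTo suc n))

upTo-< : ∀ n → All (_< n) (upTo n)
upTo-< n = Allₚ.applyUpTo⁺₁ (λ i → i) n (λ i<n → i<n)

module Comparisons where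

  open import Data.Nat using (_+_)

  T-ext : ∀ {a b} → (T a → T b) → (T b → T a) → a ≡ b
  T-ext {false} {false} _   _   = refl
  T-ext {false} {true}  _   b⇒a = ⊥-elim (b⇒a _)
  T-ext {true}  {false} a⇒b _   = ⊥-elim (a⇒b _)
  T-ext {true}  {true}  _   _   = refl

  private
    ∧-intro : ∀ {a b} → T a → T b → T (a ∧ b)
    ∧-intro ta tb = Boolₚ.T-∧ .from (ta , tb)
    ∧-elim : ∀ a {b} → T (a ∧ b) → T a × T b
    ∧-elim a = Boolₚ.T-∧ {a} .to

  <ᵇ-suc : ∀ a b → (a <ᵇ suc b) ≡ (a ≤ᵇ b)
  <ᵇ-suc zero    b = refl
  <ᵇ-suc (suc a) b = refl

  +≡ᵇ-split : ∀ q c y → (q + c ≡ᵇ y) ≡ ((c ≤ᵇ y) ∧ (q ≡ᵇ y ∸ c))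
  +≡ᵇ-split q c y = T-ext
    (λ h → let e = ℕₚ.≡ᵇ⇒≡ (q + c) y h in ∧-intro
       (ℕₚ.≤⇒≤ᵇ (subst (c ≤_) e (ℕₚ.m≤n+m c q)))
       (ℕₚ.≡⇒≡ᵇ q (y ∸ c) (trans (sym (ℕₚ.m+n∸n≡m q c)) (cong (_∸ c) e))))
    (λ h → let (c≤y , q≡y-c) = ∧-elim (c ≤ᵇ y) h in
       ℕₚ.≡⇒≡ᵇ (q + c) y (trans (cong (_+ c) (ℕₚ.≡ᵇ⇒≡ q (y ∸ c) q≡y-c))
                                (ℕₚ.m∸n+n≡m (ℕₚ.≤ᵇ⇒≤ c y c≤y))))

  ∸≡ᵇ-as-+ : ∀ {k y} c → k ≤ y → (c ≡ᵇ y ∸ k) ≡ (k + c ≡ᵇ y)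
  ∸≡ᵇ-as-+ {k} {y} c k≤y = T-ext
    (λ h → ℕₚ.≡⇒≡ᵇ (k + c) y
       (trans (cong (k +_) (ℕₚ.≡ᵇ⇒≡ c (y ∸ k) h)) (ℕₚ.m+[n∸m]≡n k≤y)))
    (λ h → ℕₚ.≡⇒≡ᵇ c (y ∸ k)
       (trans (sym (ℕₚ.m+n∸m≡n k c)) (cong (_∸ k) (ℕₚ.≡ᵇ⇒≡ (k + c) y h))))

  ≤ᵇ-∸-split : ∀ s u t → ((s ≤ᵇ t) ∧ (u ≤ᵇ t ∸ s)) ≡ (s + u ≤ᵇ t)
  ≤ᵇ-∸-split s u t = T-ext
    (λ h → let (s≤t , u≤t-s) = ∧-elim (s ≤ᵇ t) h in ℕₚ.≤⇒≤ᵇ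
       (subst (s + u ≤_) (ℕₚ.m+[n∸m]≡n (ℕₚ.≤ᵇ⇒≤ s t s≤t))
              (ℕₚ.+-monoʳ-≤ s (ℕₚ.≤ᵇ⇒≤ u (t ∸ s) u≤t-s))))
    (λ h → let s+u≤t = ℕₚ.≤ᵇ⇒≤ (s + u) t h in ∧-intro
       (ℕₚ.≤⇒≤ᵇ (ℕₚ.m+n≤o⇒m≤o s s+u≤t))
       (ℕₚ.≤⇒≤ᵇ (subst (_≤ t ∸ s) (ℕₚ.m+n∸m≡n s u) (ℕₚ.∸-monoˡ-≤ s s+u≤t))))

  ≤ᵇ-∸≡ᵇ0 : ∀ g a → ((g ≤ᵇ a) ∧ (a ∸ g ≡ᵇ 0)) ≡ (a ≡ᵇ g)
  ≤ᵇ-∸≡ᵇ0 g a = T-ext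
    (λ h → let (g≤a , a-g≡0) = ∧-elim (g ≤ᵇ a) h in ℕₚ.≡⇒≡ᵇ a g
       (ℕₚ.≤-antisym (ℕₚ.m∸n≡0⇒m≤n (ℕₚ.≡ᵇ⇒≡ (a ∸ g) 0 a-g≡0)) (ℕₚ.≤ᵇ⇒≤ g a g≤a)))
    (λ h → let a≡g = ℕₚ.≡ᵇ⇒≡ a g h in ∧-intro
       (ℕₚ.≤⇒≤ᵇ (ℕₚ.≤-reflexive (sym a≡g)))
       (ℕₚ.≡⇒≡ᵇ (a ∸ g) 0 (trans (cong (_∸ g) a≡g) (ℕₚ.n∸n≡0 g))))

open Comparisons

module SemiringSums {R : Set} {plus times : Op₂ R} {0# 1# : R}
                    (isCS : IsCommutativeSemiring _≡_ plus times 0# 1#) where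

  infixl 6 _+_
  infixl 7 _*_

  private
    _+_ _*_ : Op₂ R
    _+_ = plus
    _*_ = times

  open IsCommutativeSemiring isCS hiding (sym; trans; refl)
  open ≡-Reasoning

  ∑ : {A : Set} → (A → R) → List A → R
  ∑ f []       = 0#
  ∑ f (x ∷ xs) = f x + ∑ f xs

  ∑-++ : {A : Set} (f : A → R) (xs ys : List A) → ∑ f (xs ++ ys) ≡ ∑ f xs + ∑ f ys
  ∑-++ f []       ys = sym (+-identityˡ _)
  ∑-++ f (x ∷ xs) ys = trans (cong (f x +_) (∑-++ f xs ys)) (sym (+-assoc (f x) _ _))

  ∑-map : {A B : Set} (f : B → R) (g : A → B) (xs : List A) → ∑ f (map g xs) ≡ ∑ (f ∘ g) xs
  ∑-map f g []       = refl
  ∑-map f g (x ∷ xs) = cong (f (g x) +_) (∑-map f g xs)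

  ∑-concatMap : {A B : Set} (f : B → R) (g : A → List B) (xs : List A) →
                ∑ f (concatMap g xs) ≡ ∑ (λ x → ∑ f (g x)) xs
  ∑-concatMap f g []       = refl
  ∑-concatMap f g (x ∷ xs) =
    trans (∑-++ f (g x) (concatMap g xs)) (cong (∑ f (g x) +_) (∑-concatMap f g xs))

  ∑-cong : {A : Set} {f g : A → R} → (∀ x → f x ≡ g x) → (xs : List A) → ∑ f xs ≡ ∑ g xs
  ∑-cong f≡g []       = refl
  ∑-cong f≡g (x ∷ xs) = cong₂ _+_ (f≡g x) (∑-cong f≡g xs)

  ∑-congᴬ : {A : Set} {P : A → Set} {f g : A → R} →
            (∀ x → P x → f x ≡ g x) → {xs : List A} → All P xs → ∑ f xs ≡ ∑ g xs
  ∑-congᴬ f≡g []       = refl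
  ∑-congᴬ f≡g (p ∷ ps) = cong₂ _+_ (f≡g _ p) (∑-congᴬ f≡g ps)

  ∑-zero : {A : Set} (xs : List A) → ∑ (λ _ → 0#) xs ≡ 0#
  ∑-zero []       = refl
  ∑-zero (x ∷ xs) = trans (+-identityˡ _) (∑-zero xs)

  ∑-+ : {A : Set} (f g : A → R) (xs : List A) → ∑ (λ x → f x + g x) xs ≡ ∑ f xs + ∑ g xs
  ∑-+ f g []       = sym (+-identityˡ 0#)
  ∑-+ f g (x ∷ xs) = begin
    (f x + g x) + ∑ (λ x → f x + g x) xs   ≡⟨ cong ((f x + g x) +_) (∑-+ f g xs) ⟩
    (f x + g x) + (∑ f xs + ∑ g xs)        ≡⟨ +-assoc (f x) (g x) _ ⟩
    f x + (g x + (∑ f xs + ∑ g xs))        ≡⟨ cong (f x +_) (sym (+-assoc (g x) _ _)) ⟩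
    f x + ((g x + ∑ f xs) + ∑ g xs)        ≡⟨ cong (λ z → f x + (z + ∑ g xs)) (+-comm (g x) _) ⟩
    f x + ((∑ f xs + g x) + ∑ g xs)        ≡⟨ cong (f x +_) (+-assoc (∑ f xs) (g x) _) ⟩
    f x + (∑ f xs + (g x + ∑ g xs))        ≡⟨ sym (+-assoc (f x) _ _) ⟩
    (f x + ∑ f xs) + (g x + ∑ g xs)        ∎

  ∑-*ˡ : {A : Set} (c : R) (f : A → R) (xs : List A) → ∑ (λ x → c * f x) xs ≡ c * ∑ f xs
  ∑-*ˡ c f []       = sym (zeroʳ c)
  ∑-*ˡ c f (x ∷ xs) = trans (cong (c * f x +_) (∑-*ˡ c f xs)) (sym (distribˡ c (f x) _))

  ∑-product : {A : Set} (f : List A → R) (xs : List A) (yss : List (List A)) →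
              ∑ f (concatMap (λ x → map (x ∷_) yss) xs) ≡ ∑ (λ x → ∑ (λ ys → f (x ∷ ys)) yss) xs
  ∑-product f xs yss = trans (∑-concatMap f _ xs) (∑-cong (λ x → ∑-map f (x ∷_) yss) xs)

  ∑-comm : {A B : Set} (f : A → B → R) (xs : List A) (ys : List B) →
           ∑ (λ x → ∑ (f x) ys) xs ≡ ∑ (λ y → ∑ (λ x → f x y) xs) ys
  ∑-comm f []       ys = sym (∑-zero ys)
  ∑-comm f (x ∷ xs) ys =
    trans (cong (∑ (f x) ys +_) (∑-comm f xs ys)) (sym (∑-+ (f x) (λ y → ∑ (λ x′ → f x′ y) xs) ys))

  𝟙 : Bool → R
  𝟙 b = if b then 1# else 0#

  𝟙-∧ : ∀ a b → 𝟙 (a ∧ b) ≡ 𝟙 a * 𝟙 b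
  𝟙-∧ true  b = sym (*-identityˡ (𝟙 b))
  𝟙-∧ false b = sym (zeroˡ (𝟙 b))

  𝟙-absorb : ∀ b c → (T b → T c) → (x : R) → 𝟙 b * x ≡ 𝟙 c * (𝟙 b * x)
  𝟙-absorb false c b⇒c x = trans (zeroˡ x) (sym (trans (cong (𝟙 c *_) (zeroˡ x)) (zeroʳ (𝟙 c))))
  𝟙-absorb true  c b⇒c x with c | b⇒c _
  ... | true | _ = sym (*-identityˡ _)

  ∑-upTo-𝟙≡ᵇ : ∀ n d (h : ℕ → R) → ∑ (λ k → 𝟙 (k ≡ᵇ d) * h k) (upTo n) ≡ 𝟙 (d <ᵇ n) * h d
  ∑-upTo-𝟙≡ᵇ zero    d       h = sym (zeroˡ (h d))
  ∑-upTo-𝟙≡ᵇ (suc n) zero    h = begin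
    ∑ (λ k → 𝟙 (k ≡ᵇ 0) * h k) (upTo (suc n))
      ≡⟨ cong (∑ (λ k → 𝟙 (k ≡ᵇ 0) * h k)) (upTo-suc n) ⟩
    1# * h 0 + ∑ (λ k → 𝟙 (k ≡ᵇ 0) * h k) (map suc (upTo n))
      ≡⟨ cong (1# * h 0 +_) (∑-map _ suc (upTo n)) ⟩
    1# * h 0 + ∑ (λ k → 0# * h (suc k)) (upTo n)
      ≡⟨ cong (1# * h 0 +_) (trans (∑-cong (λ k → zeroˡ (h (suc k))) (upTo n)) (∑-zero (upTo n))) ⟩
    1# * h 0 + 0#
      ≡⟨ +-identityʳ _ ⟩
    1# * h 0 ∎
  ∑-upTo-𝟙≡ᵇ (suc n) (suc d) h = begin
    ∑ (λ k → 𝟙 (k ≡ᵇ suc d) * h k) (upTo (suc n))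
      ≡⟨ cong (∑ (λ k → 𝟙 (k ≡ᵇ suc d) * h k)) (upTo-suc n) ⟩
    0# * h 0 + ∑ (λ k → 𝟙 (k ≡ᵇ suc d) * h k) (map suc (upTo n))
      ≡⟨ cong₂ _+_ (zeroˡ (h 0)) (∑-map _ suc (upTo n)) ⟩
    0# + ∑ (λ k → 𝟙 (k ≡ᵇ d) * h (suc k)) (upTo n)
      ≡⟨ trans (+-identityˡ _) (∑-upTo-𝟙≡ᵇ n d (h ∘ suc)) ⟩
    𝟙 (d <ᵇ n) * h (suc d) ∎

  -- Peel t b F = ∑ F (b - c) over all c ≤ b (componentwise) with |c| = t.
  Peel : ℕ → List ℕ → (List ℕ → R) → R
  Peel t []      F = 𝟙 (t ≡ᵇ 0) * F []
  Peel t (y ∷ b) F = ∑ (λ k → 𝟙 (k ≤ᵇ t) * Peel (t ∸ k) b (λ v → F ((y ∸ k) ∷ v))) (upTo (suc y))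

  Peel-cong : ∀ t b {F G : List ℕ → R} → (∀ v → length v ≡ length b → F v ≡ G v) →
              Peel t b F ≡ Peel t b G
  Peel-cong t []      F≡G = cong (𝟙 (t ≡ᵇ 0) *_) (F≡G [] refl)
  Peel-cong t (y ∷ b) F≡G = ∑-cong (λ k → cong (𝟙 (k ≤ᵇ t) *_)
    (Peel-cong (t ∸ k) b (λ v ∣v∣≡ → F≡G _ (cong suc ∣v∣≡)))) (upTo (suc y))

  x*yz≡y*xz : ∀ x y z → x * (y * z) ≡ y * (x * z)
  x*yz≡y*xz x y z = trans (sym (*-assoc x y z)) (trans (cong (_* z) (*-comm x y)) (*-assoc y x z))

  Peel-*ˡ : ∀ t b a F → Peel t b (λ v → a * F v) ≡ a * Peel t b F
  Peel-*ˡ t []      a F = x*yz≡y*xz (𝟙 (t ≡ᵇ 0)) a (F [])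
  Peel-*ˡ t (y ∷ b) a F = trans
    (∑-cong (λ k → trans (cong (𝟙 (k ≤ᵇ t) *_) (Peel-*ˡ (t ∸ k) b a _))
                         (x*yz≡y*xz (𝟙 (k ≤ᵇ t)) a _)) (upTo (suc y)))
    (∑-*ˡ a _ (upTo (suc y)))

  Peel-+ : ∀ t b F G → Peel t b (λ v → F v + G v) ≡ Peel t b F + Peel t b G
  Peel-+ t []      F G = distribˡ (𝟙 (t ≡ᵇ 0)) (F []) (G [])
  Peel-+ t (y ∷ b) F G = trans
    (∑-cong (λ k → trans (cong (𝟙 (k ≤ᵇ t) *_) (Peel-+ (t ∸ k) b _ _)) (distribˡ (𝟙 (k ≤ᵇ t)) _ _))
            (upTo (suc y)))
    (∑-+ _ _ (upTo (suc y)))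

  Peel-zero : ∀ t b → Peel t b (λ _ → 0#) ≡ 0#
  Peel-zero t []      = zeroʳ (𝟙 (t ≡ᵇ 0))
  Peel-zero t (y ∷ b) = trans
    (∑-cong (λ k → trans (cong (𝟙 (k ≤ᵇ t) *_) (Peel-zero (t ∸ k) b)) (zeroʳ (𝟙 (k ≤ᵇ t))))
            (upTo (suc y)))
    (∑-zero (upTo (suc y)))

  Peel-∑ : {A : Set} (t : ℕ) (b : List ℕ) (g : A → List ℕ → R) (xs : List A) →
           Peel t b (λ v → ∑ (λ x → g x v) xs) ≡ ∑ (λ x → Peel t b (g x)) xs
  Peel-∑ t b g []       = Peel-zero t b
  Peel-∑ t b g (x ∷ xs) = trans (Peel-+ t b (g x) _) (cong (Peel t b (g x) +_) (Peel-∑ t b g xs))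

  Peel-nothing : ∀ b F → Peel 0 b F ≡ F b
  Peel-nothing []      F = *-identityˡ (F [])
  Peel-nothing (y ∷ b) F = begin
    ∑ (λ k → 𝟙 (k ≤ᵇ 0) * Peel (0 ∸ k) b (λ v → F ((y ∸ k) ∷ v))) (upTo (suc y))
      ≡⟨ cong (∑ _) (upTo-suc y) ⟩
    1# * Peel 0 b (λ v → F (y ∷ v)) + ∑ _ (map suc (upTo y))
      ≡⟨ cong₂ _+_ (*-identityˡ _) (∑-map _ suc (upTo y)) ⟩
    Peel 0 b (λ v → F (y ∷ v)) + ∑ (λ k → 0# * _) (upTo y)
      ≡⟨ cong₂ _+_ (Peel-nothing b (λ v → F (y ∷ v)))
                   (trans (∑-cong (λ k → zeroˡ _) (upTo y)) (∑-zero (upTo y))) ⟩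
    F (y ∷ b) + 0#
      ≡⟨ +-identityʳ _ ⟩
    F (y ∷ b) ∎

module ℕΣ = SemiringSums ℕₚ.+-*-isCommutativeSemiring
module ℚΣ = SemiringSums (IsCommutativeRing.isCommutativeSemiring ℚₚ.+-*-isCommutativeRing)

module Immaculate where

  open import Data.Nat using (_+_; _*_)
  open ℕΣ
  open Boolₚ using (T-∧; T-≡)
  open ≡-Reasoning

  skip : ℕ → ℕ → ℕ
  skip j       zero    = zero
  skip zero    (suc y) = suc (suc y)
  skip (suc j) (suc y) = suc (skip j y)

  skip-≡ᵇ : ∀ j x y → (skip j x ≡ᵇ skip j y) ≡ (x ≡ᵇ y)
  skip-≡ᵇ j       zero    zero    = refl
  skip-≡ᵇ zero    zero    (suc y) = refl
  skip-≡ᵇ (suc j) zero    (suc y) = refl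
  skip-≡ᵇ zero    (suc x) zero    = refl
  skip-≡ᵇ (suc j) (suc x) zero    = refl
  skip-≡ᵇ zero    (suc x) (suc y) = refl
  skip-≡ᵇ (suc j) (suc x) (suc y) = skip-≡ᵇ j x y

  skip-<ᵇ : ∀ j x y → (skip j x <ᵇ skip j y) ≡ (x <ᵇ y)
  skip-<ᵇ j       zero    zero    = refl
  skip-<ᵇ zero    zero    (suc y) = refl
  skip-<ᵇ (suc j) zero    (suc y) = refl
  skip-<ᵇ zero    (suc x) zero    = refl
  skip-<ᵇ (suc j) (suc x) zero    = refl
  skip-<ᵇ zero    (suc x) (suc y) = refl
  skip-<ᵇ (suc j) (suc x) (suc y) = skip-<ᵇ j x y

  skip-≤ᵇ : ∀ j x y → (skip j x ≤ᵇ skip j y) ≡ (x ≤ᵇ y)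
  skip-≤ᵇ j       zero    y       = refl
  skip-≤ᵇ zero    (suc x) zero    = refl
  skip-≤ᵇ (suc j) (suc x) zero    = refl
  skip-≤ᵇ zero    (suc x) (suc y) = refl
  skip-≤ᵇ (suc j) (suc x) (suc y) =
    trans (<ᵇ-suc (skip j x) (skip j y)) (trans (skip-≤ᵇ j x y) (sym (<ᵇ-suc x y)))

  skip-below : ∀ {j i} → i ≤ j → skip j i ≡ i
  skip-below {i = zero}      _         = refl
  skip-below {suc j} {suc i} (s≤s i≤j) = cong suc (skip-below i≤j)

  skip-above : ∀ {j i} → j < i → skip j i ≡ suc i
  skip-above {zero}  {suc i} _         = refl
  skip-above {suc j} {suc i} (s≤s j<i) = cong suc (skip-above j<i)

  skip-misses : ∀ j e → (suc j ≡ᵇ skip j e) ≡ false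
  skip-misses j       zero    = refl
  skip-misses zero    (suc e) = refl
  skip-misses (suc j) (suc e) = skip-misses j e

  count-++ : ∀ i xs ys → count i (xs ++ ys) ≡ count i xs + count i ys
  count-++ i []       ys = refl
  count-++ i (x ∷ xs) ys with i ≡ᵇ x
  ... | true  = cong suc (count-++ i xs ys)
  ... | false = count-++ i xs ys

  count-map : ∀ f → (∀ x y → (f x ≡ᵇ f y) ≡ (x ≡ᵇ y)) → ∀ i es → count (f i) (map f es) ≡ count i es
  count-map f f-≡ᵇ i []       = refl
  count-map f f-≡ᵇ i (e ∷ es) rewrite f-≡ᵇ i e with i ≡ᵇ e
  ... | true  = cong suc (count-map f f-≡ᵇ i es)
  ... | false = count-map f f-≡ᵇ i es

  count-skip-missed : ∀ j es → count (suc j) (map (skip j) es) ≡ 0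
  count-skip-missed j []       = refl
  count-skip-missed j (e ∷ es) rewrite skip-misses j e = count-skip-missed j es

  contentOK-++ : ∀ i es x y → contentOK i es (x ++ y) ≡ (contentOK i es x ∧ contentOK (i + length x) es y)
  contentOK-++ i es []      y = cong (λ k → contentOK k es y) (sym (ℕₚ.+-identityʳ i))
  contentOK-++ i es (b ∷ x) y
    rewrite contentOK-++ (suc i) es x y | ℕₚ.+-suc i (length x)
          | Boolₚ.∧-assoc (count i es ≡ᵇ b) (contentOK (suc i) es x) (contentOK (suc (i + length x)) es y)
    = refl

  contentOK-cong : ∀ d i b {es₁ es₂} →
                   (∀ k → i ≤ k → k < i + length b → count (d + k) es₁ ≡ count k es₂) →
                   contentOK (d + i) es₁ b ≡ contentOK i es₂ b
  contentOK-cong d i []      h = refl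
  contentOK-cong d i (x ∷ b) {es₁} h = cong₂ _∧_
    (cong (_≡ᵇ x) (h i ℕₚ.≤-refl (ℕₚ.m<m+n i (s≤s z≤n))))
    (trans (cong (λ k → contentOK k es₁ b) (sym (ℕₚ.+-suc d i)))
           (contentOK-cong d (suc i) b (λ k i<k k<i+b →
              h k (ℕₚ.<⇒≤ i<k) (subst (k <_) (sym (ℕₚ.+-suc i (length b))) k<i+b))))

  contentOK-insert-zero : ∀ es x y →
    contentOK 1 (map (skip (length x)) es) (x ++ 0 ∷ y) ≡ contentOK 1 es (x ++ y)
  contentOK-insert-zero es x y = begin
    contentOK 1 es′ (x ++ 0 ∷ y)
      ≡⟨ contentOK-++ 1 es′ x (0 ∷ y) ⟩
    contentOK 1 es′ x ∧ ((count (suc ∣x∣) es′ ≡ᵇ 0) ∧ contentOK (suc (suc ∣x∣)) es′ y)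
      ≡⟨ cong₂ (λ a z → a ∧ ((z ≡ᵇ 0) ∧ contentOK (suc (suc ∣x∣)) es′ y))
               below (count-skip-missed ∣x∣ es) ⟩
    contentOK 1 es x ∧ contentOK (suc (suc ∣x∣)) es′ y
      ≡⟨ cong (contentOK 1 es x ∧_) above ⟩
    contentOK 1 es x ∧ contentOK (suc ∣x∣) es y
      ≡⟨ sym (contentOK-++ 1 es x y) ⟩
    contentOK 1 es (x ++ y) ∎
    where
    ∣x∣ = length x
    es′ = map (skip ∣x∣) es
    count-skip : ∀ {k} → count (skip ∣x∣ k) es′ ≡ count k es
    count-skip {k} = count-map (skip ∣x∣) (skip-≡ᵇ ∣x∣) k es
    below : contentOK 1 es′ x ≡ contentOK 1 es x
    below = contentOK-cong 0 1 x (λ k _ k≤x →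
      trans (cong (λ z → count z es′) (sym (skip-below (ℕₚ.≤-pred k≤x)))) count-skip)
    above : contentOK (suc (suc ∣x∣)) es′ y ≡ contentOK (suc ∣x∣) es y
    above = contentOK-cong 1 (suc ∣x∣) y (λ k x<k _ →
      trans (cong (λ z → count z es′) (sym (skip-above x<k))) count-skip)

  weakIncr-map : ∀ f → (∀ x y → (f x ≤ᵇ f y) ≡ (x ≤ᵇ y)) → ∀ r → weakIncr (map f r) ≡ weakIncr r
  weakIncr-map f f-≤ᵇ []          = refl
  weakIncr-map f f-≤ᵇ (x ∷ [])     = refl
  weakIncr-map f f-≤ᵇ (x ∷ y ∷ r) = cong₂ _∧_ (f-≤ᵇ x y) (weakIncr-map f f-≤ᵇ (y ∷ r))

  strictIncr-map : ∀ f → (∀ x y → (f x <ᵇ f y) ≡ (x <ᵇ y)) → ∀ r → strictIncr (map f r) ≡ strictIncr r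
  strictIncr-map f f-<ᵇ []          = refl
  strictIncr-map f f-<ᵇ (x ∷ [])     = refl
  strictIncr-map f f-<ᵇ (x ∷ y ∷ r) = cong₂ _∧_ (f-<ᵇ x y) (strictIncr-map f f-<ᵇ (y ∷ r))

  allWeakIncr-map : ∀ f → (∀ x y → (f x ≤ᵇ f y) ≡ (x ≤ᵇ y)) →
                    ∀ τ → allB weakIncr (map (map f) τ) ≡ allB weakIncr τ
  allWeakIncr-map f f-≤ᵇ []      = refl
  allWeakIncr-map f f-≤ᵇ (r ∷ τ) = cong₂ _∧_ (weakIncr-map f f-≤ᵇ r) (allWeakIncr-map f f-≤ᵇ τ)

  firstColumn-map : ∀ f τ → firstColumn (map (map f) τ) ≡ map f (firstColumn τ)
  firstColumn-map f []            = refl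
  firstColumn-map f ([] ∷ τ)      = firstColumn-map f τ
  firstColumn-map f ((x ∷ r) ∷ τ) = cong (f x ∷_) (firstColumn-map f τ)

  isImmaculate-skip : ∀ x y τ →
    isImmaculate (x ++ 0 ∷ y) (map (map (skip (length x))) τ) ≡ isImmaculate (x ++ y) τ
  isImmaculate-skip x y τ = cong₂ _∧_ (allWeakIncr-map s (skip-≤ᵇ j) τ) (cong₂ _∧_
    (trans (cong strictIncr (firstColumn-map s τ)) (strictIncr-map s (skip-<ᵇ j) (firstColumn τ)))
    (trans (cong (λ es → contentOK 1 es (x ++ 0 ∷ y)) (Listₚ.concat-map τ))
           (contentOK-insert-zero (flatten τ) x y)))
    where j = length x
          s = skip j

  letters : ℕ → List ℕ
  letters m = map suc (upTo m)

  letters-suc : ∀ m → letters (suc m) ≡ 1 ∷ map suc (letters m)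
  letters-suc m = cong (λ l → map suc l) (upTo-suc m)

  avoids : ℕ → List ℕ → Bool
  avoids i es = count i es ≡ᵇ 0

  avoids-++ : ∀ i xs ys → avoids i (xs ++ ys) ≡ (avoids i xs ∧ avoids i ys)
  avoids-++ i xs ys rewrite count-++ i xs ys with count i xs
  ... | zero  = refl
  ... | suc _ = refl

  ∑-letters-avoiding : ∀ {j m} → j ≤ m → (g : ℕ → ℕ) →
    ∑ (λ x → 𝟙 (avoids (suc j) (x ∷ [])) * g x) (letters (suc m)) ≡ ∑ (g ∘ skip j) (letters m)
  ∑-letters-avoiding {zero} {m} _ g = begin
    ∑ h (letters (suc m))                ≡⟨ cong (∑ h) (letters-suc m) ⟩
    ∑ h (map suc (letters m))            ≡⟨ ∑-map h suc (letters m) ⟩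
    ∑ (h ∘ suc) (map suc (upTo m))       ≡⟨ ∑-map (h ∘ suc) suc (upTo m) ⟩
    ∑ (h ∘ suc ∘ suc) (upTo m)           ≡⟨ ∑-cong (λ z → ℕₚ.+-identityʳ (g (suc (suc z)))) (upTo m) ⟩
    ∑ (g ∘ skip 0 ∘ suc) (upTo m)        ≡⟨ sym (∑-map (g ∘ skip 0) suc (upTo m)) ⟩
    ∑ (g ∘ skip 0) (letters m)           ∎
    where h = λ x → 𝟙 (avoids 1 (x ∷ [])) * g x
  ∑-letters-avoiding {suc j} {suc m} (s≤s j≤m) g = begin
    ∑ h (letters (suc (suc m)))
      ≡⟨ cong (∑ h) (letters-suc (suc m)) ⟩
    1 * g 1 + ∑ h (map suc (letters (suc m)))
      ≡⟨ cong₂ _+_ (ℕₚ.*-identityˡ (g 1)) (∑-map h suc (letters (suc m))) ⟩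
    g 1 + ∑ (h ∘ suc) (letters (suc m))
      ≡⟨ cong (g 1 +_) (∑-letters-avoiding j≤m (g ∘ suc)) ⟩
    g 1 + ∑ (g ∘ suc ∘ skip j) (letters m)
      ≡⟨ cong (g 1 +_) (sym (∑-map (g ∘ skip (suc j)) suc (letters m))) ⟩
    g 1 + ∑ (g ∘ skip (suc j)) (map suc (letters m))
      ≡⟨ cong (∑ (g ∘ skip (suc j))) (sym (letters-suc m)) ⟩
    ∑ (g ∘ skip (suc j)) (letters (suc m)) ∎
    where h = λ x → 𝟙 (avoids (suc (suc j)) (x ∷ [])) * g x

  𝟙-avoids-++ : ∀ i xs ys v → 𝟙 (avoids i (xs ++ ys)) * v ≡ 𝟙 (avoids i xs) * (𝟙 (avoids i ys) * v)
  𝟙-avoids-++ i xs ys v = trans (cong (λ b → 𝟙 b * v) (avoids-++ i xs ys))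
    (trans (cong (_* v) (𝟙-∧ (avoids i xs) _)) (ℕₚ.*-assoc (𝟙 (avoids i xs)) _ v))

  ∑-rowsOf-avoiding : ∀ {j m} → j ≤ m → ∀ k (f : List ℕ → ℕ) →
    ∑ (λ r → 𝟙 (avoids (suc j) r) * f r) (rowsOf k (suc m)) ≡ ∑ (f ∘ map (skip j)) (rowsOf k m)
  ∑-rowsOf-avoiding j≤m zero    f = cong (_+ 0) (ℕₚ.*-identityˡ (f []))
  ∑-rowsOf-avoiding {j} {m} j≤m (suc k) f = begin
    ∑ (λ r → 𝟙 (avoids (suc j) r) * f r) (rowsOf (suc k) (suc m))
      ≡⟨ ∑-product _ (letters (suc m)) (rowsOf k (suc m)) ⟩
    ∑ (λ x → ∑ (λ r → 𝟙 (avoids (suc j) (x ∷ r)) * f (x ∷ r)) (rowsOf k (suc m))) (letters (suc m))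
      ≡⟨ ∑-cong (λ x → trans (∑-cong (λ r → 𝟙-avoids-++ (suc j) (x ∷ []) r _) (rowsOf k (suc m)))
                             (∑-*ˡ (𝟙 (avoids (suc j) (x ∷ []))) _ (rowsOf k (suc m)))) (letters (suc m)) ⟩
    ∑ (λ x → 𝟙 (avoids (suc j) (x ∷ [])) * ∑ (λ r → 𝟙 (avoids (suc j) r) * f (x ∷ r)) (rowsOf k (suc m)))
      (letters (suc m))
      ≡⟨ ∑-cong (λ x → cong (𝟙 (avoids (suc j) (x ∷ [])) *_) (∑-rowsOf-avoiding j≤m k (λ r → f (x ∷ r))))
                (letters (suc m)) ⟩
    ∑ (λ x → 𝟙 (avoids (suc j) (x ∷ [])) * ∑ (λ r → f (x ∷ map (skip j) r)) (rowsOf k m)) (letters (suc m))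
      ≡⟨ ∑-letters-avoiding j≤m (λ x → ∑ (λ r → f (x ∷ map (skip j) r)) (rowsOf k m)) ⟩
    ∑ (λ y → ∑ (λ r → f (map (skip j) (y ∷ r))) (rowsOf k m)) (letters m)
      ≡⟨ sym (∑-product (f ∘ map (skip j)) (letters m) (rowsOf k m)) ⟩
    ∑ (f ∘ map (skip j)) (rowsOf (suc k) m) ∎

  ∑-fillings-avoiding : ∀ {j m} → j ≤ m → ∀ α (f : List (List ℕ) → ℕ) →
    ∑ (λ τ → 𝟙 (avoids (suc j) (flatten τ)) * f τ) (fillings α (suc m)) ≡
    ∑ (f ∘ map (map (skip j))) (fillings α m)
  ∑-fillings-avoiding j≤m []      f = cong (_+ 0) (ℕₚ.*-identityˡ (f []))
  ∑-fillings-avoiding {j} {m} j≤m (a ∷ α) f = begin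
    ∑ (λ τ → 𝟙 (avoids (suc j) (flatten τ)) * f τ) (fillings (a ∷ α) (suc m))
      ≡⟨ ∑-product _ (rowsOf a (suc m)) (fillings α (suc m)) ⟩
    ∑ (λ r → ∑ (λ τ → 𝟙 (avoids (suc j) (r ++ flatten τ)) * f (r ∷ τ)) (fillings α (suc m))) (rowsOf a (suc m))
      ≡⟨ ∑-cong (λ r → trans (∑-cong (λ τ → 𝟙-avoids-++ (suc j) r (flatten τ) _) (fillings α (suc m)))
                             (∑-*ˡ (𝟙 (avoids (suc j) r)) _ (fillings α (suc m)))) (rowsOf a (suc m)) ⟩
    ∑ (λ r → 𝟙 (avoids (suc j) r) *
             ∑ (λ τ → 𝟙 (avoids (suc j) (flatten τ)) * f (r ∷ τ)) (fillings α (suc m)))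
      (rowsOf a (suc m))
      ≡⟨ ∑-cong (λ r → cong (𝟙 (avoids (suc j) r) *_) (∑-fillings-avoiding j≤m α (λ τ → f (r ∷ τ))))
                (rowsOf a (suc m)) ⟩
    ∑ (λ r → 𝟙 (avoids (suc j) r) * ∑ (λ τ → f (r ∷ map (map (skip j)) τ)) (fillings α m)) (rowsOf a (suc m))
      ≡⟨ ∑-rowsOf-avoiding j≤m a (λ r → ∑ (λ τ → f (r ∷ map (map (skip j)) τ)) (fillings α m)) ⟩
    ∑ (λ r → ∑ (λ τ → f (map (map (skip j)) (r ∷ τ))) (fillings α m)) (rowsOf a m)
      ≡⟨ sym (∑-product (f ∘ map (map (skip j))) (rowsOf a m) (fillings α m)) ⟩
    ∑ (f ∘ map (map (skip j))) (fillings (a ∷ α) m) ∎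

  ∑-as-sum : {A : Set} (f : A → ℕ) (xs : List A) → sum (map f xs) ≡ ∑ f xs
  ∑-as-sum f []       = refl
  ∑-as-sum f (x ∷ xs) = cong (f x +_) (∑-as-sum f xs)

  K-as-∑ : ∀ α β → K α β ≡ ∑ (λ τ → 𝟙 (isImmaculate β τ)) (fillings α (length β))
  K-as-∑ α β = ∑-as-sum _ (fillings α (length β))

  immaculate⇒contentOK : ∀ β τ → T (isImmaculate β τ) → T (contentOK 1 (flatten τ) β)
  immaculate⇒contentOK β τ imm =
    proj₂ (T-∧ {strictIncr (firstColumn τ)} .to (proj₂ (T-∧ {allB weakIncr τ} .to imm)))

  contentOK-zero⇒avoids : ∀ i es x y → T (contentOK i es (x ++ 0 ∷ y)) → T (avoids (i + length x) es)
  contentOK-zero⇒avoids i es x y ok = proj₁ (T-∧ {avoids (i + length x) es} .to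
    (proj₂ (T-∧ {contentOK i es x} .to (subst T (contentOK-++ i es x (0 ∷ y)) ok))))

  K-insert-zero : ∀ α x y → K α (x ++ 0 ∷ y) ≡ K α (x ++ y)
  K-insert-zero α x y = begin
    K α β₀
      ≡⟨ K-as-∑ α β₀ ⟩
    ∑ (λ τ → 𝟙 (isImmaculate β₀ τ)) (fillings α (length β₀))
      ≡⟨ cong (λ n → ∑ (λ τ → 𝟙 (isImmaculate β₀ τ)) (fillings α n)) (Listₚ.length-++-sucʳ x 0 y) ⟩
    ∑ (λ τ → 𝟙 (isImmaculate β₀ τ)) (fillings α (suc m))
      ≡⟨ ∑-cong (λ τ → trans (sym (ℕₚ.*-identityʳ _))
           (𝟙-absorb _ (avoids (suc (length x)) (flatten τ))
              (contentOK-zero⇒avoids 1 (flatten τ) x y ∘ immaculate⇒contentOK β₀ τ) 1))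
           (fillings α (suc m)) ⟩
    ∑ (λ τ → 𝟙 (avoids (suc (length x)) (flatten τ)) * (𝟙 (isImmaculate β₀ τ) * 1)) (fillings α (suc m))
      ≡⟨ ∑-fillings-avoiding (Listₚ.length-++-≤ˡ x) α (λ τ → 𝟙 (isImmaculate β₀ τ) * 1) ⟩
    ∑ (λ τ → 𝟙 (isImmaculate β₀ (map (map (skip (length x))) τ)) * 1) (fillings α m)
      ≡⟨ ∑-cong (λ τ → trans (ℕₚ.*-identityʳ _) (cong 𝟙 (isImmaculate-skip x y τ))) (fillings α m) ⟩
    ∑ (λ τ → 𝟙 (isImmaculate (x ++ y) τ)) (fillings α m)
      ≡⟨ sym (K-as-∑ α (x ++ y)) ⟩
    K α (x ++ y) ∎
    where
    β₀ = x ++ 0 ∷ y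
    m = length (x ++ y)

  K-strip : ∀ α v → K α (strip v) ≡ K α v
  K-strip α = go []
    where
    go : ∀ x v → K α (x ++ strip v) ≡ K α (x ++ v)
    go x []            = refl
    go x (zero ∷ v)    = trans (go x v) (sym (K-insert-zero α x v))
    go x (suc k ∷ v)   = trans (cong (K α) (sym (Listₚ.++-assoc x (suc k ∷ []) (strip v))))
      (trans (go (x ++ suc k ∷ []) v) (cong (K α) (Listₚ.++-assoc x (suc k ∷ []) v)))

  Positive : List ℕ → Set
  Positive = All (0 <_)

  All-product : {A : Set} {P : A → Set} {Q : List A → Set} {R : List A → Set} →
                (∀ {x ys} → P x → Q ys → R (x ∷ ys)) →
                ∀ {xs yss} → All P xs → All Q yss → All R (concatMap (λ x → map (x ∷_) yss) xs)
  All-product cons pxs qyss =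
    Allₚ.concat⁺ (Allₚ.map⁺ (All.map (λ px → Allₚ.map⁺ (All.map (cons px) qyss)) pxs))

  letters-positive : ∀ m → Positive (letters m)
  letters-positive m = Allₚ.map⁺ (All.universal (λ _ → s≤s z≤n) (upTo m))

  rowsOf-shape : ∀ k m → All (λ r → Positive r × length r ≡ k) (rowsOf k m)
  rowsOf-shape zero    m = ([] , refl) ∷ []
  rowsOf-shape (suc k) m = All-product (λ { x>0 (r>0 , ∣r∣≡k) → (x>0 ∷ r>0) , cong suc ∣r∣≡k })
    (letters-positive m) (rowsOf-shape k m)

  rowsOf-positive : ∀ k m → All Positive (rowsOf k m)
  rowsOf-positive k m = All.map proj₁ (rowsOf-shape k m)

  fillings-positive : ∀ α m → All (All Positive) (fillings α m)
  fillings-positive []      m = [] ∷ []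
  fillings-positive (a ∷ α) m = All-product _∷_ (rowsOf-positive a m) (fillings-positive α m)

  weakIncr-one : ∀ r → Positive r → weakIncr (1 ∷ r) ≡ weakIncr r
  weakIncr-one []          _        = refl
  weakIncr-one (suc y ∷ r) _        = refl
  weakIncr-one (zero ∷ r)  (() ∷ _)

  weakIncr⇒All≥ : ∀ x r → T (weakIncr (x ∷ r)) → All (x ≤_) r
  weakIncr⇒All≥ x []      _ = []
  weakIncr⇒All≥ x (e ∷ r) w with T-∧ {x ≤ᵇ e} .to w
  ... | x≤ᵇe , w′ = x≤e ∷ All.map (ℕₚ.≤-trans x≤e) (weakIncr⇒All≥ e r w′)
    where x≤e = ℕₚ.≤ᵇ⇒≤ x e x≤ᵇe

  all>⇒avoids : ∀ {h} es → All (h <_) es → T (avoids h es)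
  all>⇒avoids         []       []       = _
  all>⇒avoids {h} (e ∷ es) (h<e ∷ ps) with h ≡ᵇ e in h≡ᵇe
  ... | false = all>⇒avoids es ps
  ... | true  = ⊥-elim (ℕₚ.<-irrefl (ℕₚ.≡ᵇ⇒≡ h e (subst T (sym h≡ᵇe) _)) h<e)

  weakIncr-avoids-one : ∀ y r → 0 < y → T (weakIncr (suc y ∷ r)) → T (avoids 1 r)
  weakIncr-avoids-one y r y>0 w =
    all>⇒avoids r (All.map (ℕₚ.<-≤-trans (s≤s y>0)) (weakIncr⇒All≥ (suc y) r w))

  -- A weakly increasing row over 1, …, m + 1 is a block of q ones followed by a
  -- weakly increasing row over 2, …, m + 1.
  ∑-weakRows-split : ∀ m t (f : List ℕ → ℕ) →
    ∑ (λ r → 𝟙 (weakIncr r) * f r) (rowsOf t (suc m)) ≡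
    ∑ (λ q → ∑ (λ r → 𝟙 (weakIncr r) * f (replicate q 1 ++ map (skip 0) r)) (rowsOf (t ∸ q) m)) (upTo (suc t))
  ∑-weakRows-split m zero    f = sym (ℕₚ.+-identityʳ _)
  ∑-weakRows-split m (suc t) f = begin
    ∑ H (rowsOf (suc t) (suc m))
      ≡⟨ ∑-product H (letters (suc m)) (rowsOf t (suc m)) ⟩
    ∑ (λ x → ∑ (λ r → H (x ∷ r)) (rowsOf t (suc m))) (letters (suc m))
      ≡⟨ cong (∑ (λ x → ∑ (λ r → H (x ∷ r)) (rowsOf t (suc m)))) (letters-suc m) ⟩
    ∑ (λ r → H (1 ∷ r)) (rowsOf t (suc m)) +
    ∑ (λ x → ∑ (λ r → H (x ∷ r)) (rowsOf t (suc m))) (map suc (letters m))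
      ≡⟨ cong₂ _+_ leading-one (trans (∑-map _ suc (letters m)) leading-above-one) ⟩
    ∑ (G ∘ suc) (upTo (suc t)) + G 0
      ≡⟨ ℕₚ.+-comm _ (G 0) ⟩
    G 0 + ∑ (G ∘ suc) (upTo (suc t))
      ≡⟨ cong (G 0 +_) (sym (∑-map G suc (upTo (suc t)))) ⟩
    ∑ G (0 ∷ map suc (upTo (suc t)))
      ≡⟨ cong (∑ G) (sym (upTo-suc (suc t))) ⟩
    ∑ G (upTo (suc (suc t))) ∎
    where
    H : List ℕ → ℕ
    H r = 𝟙 (weakIncr r) * f r
    G : ℕ → ℕ
    G q = ∑ (λ r → 𝟙 (weakIncr r) * f (replicate q 1 ++ map (skip 0) r)) (rowsOf (suc t ∸ q) m)
    leading-one : ∑ (λ r → H (1 ∷ r)) (rowsOf t (suc m)) ≡ ∑ (G ∘ suc) (upTo (suc t))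
    leading-one = trans
      (∑-congᴬ (λ r r>0 → cong (λ b → 𝟙 b * f (1 ∷ r)) (weakIncr-one r r>0)) (rowsOf-positive t (suc m)))
      (∑-weakRows-split m t (λ r → f (1 ∷ r)))
    leading-above-one : ∑ (λ y → ∑ (λ r → H (suc y ∷ r)) (rowsOf t (suc m))) (letters m) ≡ G 0
    leading-above-one = begin
      ∑ (λ y → ∑ (λ r → H (suc y ∷ r)) (rowsOf t (suc m))) (letters m)
        ≡⟨ ∑-congᴬ (λ y y>0 → trans
             (∑-cong (λ r → 𝟙-absorb _ (avoids 1 r) (weakIncr-avoids-one y r y>0) (f (suc y ∷ r))) (rowsOf t (suc m)))
             (∑-rowsOf-avoiding z≤n t (λ r → H (suc y ∷ r)))) (letters-positive m) ⟩
      ∑ (λ y → ∑ (λ r → H (suc y ∷ map (skip 0) r)) (rowsOf t m)) (letters m)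
        ≡⟨ ∑-congᴬ (λ { (suc z) _ → ∑-cong (λ r → cong (λ b → 𝟙 b * f (map (skip 0) (suc z ∷ r)))
             (weakIncr-map (skip 0) (skip-≤ᵇ 0) (suc z ∷ r))) (rowsOf t m) }) (letters-positive m) ⟩
      ∑ (λ y → ∑ (λ r → 𝟙 (weakIncr (y ∷ r)) * f (map (skip 0) (y ∷ r))) (rowsOf t m)) (letters m)
        ≡⟨ sym (∑-product (λ r → 𝟙 (weakIncr r) * f (map (skip 0) r)) (letters m) (rowsOf t m)) ⟩
      G 0 ∎

  count-one-replicate : ∀ q → count 1 (replicate q 1) ≡ q
  count-one-replicate zero    = refl
  count-one-replicate (suc q) = cong suc (count-one-replicate q)

  count-replicate-one : ∀ k q → count (suc (suc k)) (replicate q 1) ≡ 0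
  count-replicate-one k zero    = refl
  count-replicate-one k (suc q) = count-replicate-one k q

  count-pred : ∀ k es → count (suc (suc k)) es ≡ count (suc k) (map pred es)
  count-pred k []           = refl
  count-pred k (zero ∷ es)  = count-pred k es
  count-pred k (suc e ∷ es) with suc k ≡ᵇ e
  ... | true  = cong suc (count-pred k es)
  ... | false = count-pred k es

  contentOK-ones-skip : ∀ q L es p b →
    contentOK 1 ((replicate q 1 ++ map (skip 0) L) ++ es) (p ∷ b) ≡
    ((q + count 1 es ≡ᵇ p) ∧ contentOK 1 (L ++ map pred es) b)
  contentOK-ones-skip q L es p b = cong₂ _∧_ (cong (_≡ᵇ p) ones) (contentOK-cong 1 1 b (λ { (suc k) _ _ → above k }))
    where
    ones : count 1 ((replicate q 1 ++ map (skip 0) L) ++ es) ≡ q + count 1 es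
    ones rewrite count-++ 1 (replicate q 1 ++ map (skip 0) L) es | count-++ 1 (replicate q 1) (map (skip 0) L)
               | count-one-replicate q | count-skip-missed 0 L | ℕₚ.+-identityʳ q = refl
    above : ∀ k → count (suc (suc k)) ((replicate q 1 ++ map (skip 0) L) ++ es) ≡ count (suc k) (L ++ map pred es)
    above k rewrite count-++ (suc (suc k)) (replicate q 1 ++ map (skip 0) L) es
                  | count-++ (suc (suc k)) (replicate q 1) (map (skip 0) L) | count-replicate-one k q
                  | count-++ (suc k) L (map pred es) | count-pred k es
                  = cong (_+ count (suc k) (map pred es)) (count-map (skip 0) (skip-≡ᵇ 0) (suc k) L)

  ∑-upTo-𝟙+≡ᵇ : ∀ n c y (h : ℕ → ℕ) →
    ∑ (λ k → 𝟙 (k + c ≡ᵇ y) * h k) (upTo n) ≡ 𝟙 (c ≤ᵇ y) * (𝟙 (y ∸ c <ᵇ n) * h (y ∸ c))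
  ∑-upTo-𝟙+≡ᵇ n c y h = begin
    ∑ (λ k → 𝟙 (k + c ≡ᵇ y) * h k) (upTo n)
      ≡⟨ ∑-cong (λ k → trans (cong (λ b → 𝟙 b * h k) (+≡ᵇ-split k c y))
                      (trans (cong (_* h k) (𝟙-∧ (c ≤ᵇ y) _)) (ℕₚ.*-assoc (𝟙 (c ≤ᵇ y)) _ _))) (upTo n) ⟩
    ∑ (λ k → 𝟙 (c ≤ᵇ y) * (𝟙 (k ≡ᵇ y ∸ c) * h k)) (upTo n)
      ≡⟨ ∑-*ˡ (𝟙 (c ≤ᵇ y)) _ (upTo n) ⟩
    𝟙 (c ≤ᵇ y) * ∑ (λ k → 𝟙 (k ≡ᵇ y ∸ c) * h k) (upTo n)
      ≡⟨ cong (𝟙 (c ≤ᵇ y) *_) (∑-upTo-𝟙≡ᵇ n (y ∸ c) h) ⟩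
    𝟙 (c ≤ᵇ y) * (𝟙 (y ∸ c <ᵇ n) * h (y ∸ c)) ∎

  contentOK-pred : ∀ b es → contentOK 2 es b ≡ contentOK 1 (map pred es) b
  contentOK-pred b es = contentOK-cong 1 1 b (λ { (suc k) _ _ → count-pred k es })

  ∑-upTo-𝟙+≡ᵇ-bound : ∀ t c y (h : ℕ → ℕ) →
    ∑ (λ k → 𝟙 (k + c ≡ᵇ y) * h k) (upTo (suc t)) ≡
    ∑ (λ k → 𝟙 (k + c ≡ᵇ y) * (𝟙 (k ≤ᵇ t) * h k)) (upTo (suc y))
  ∑-upTo-𝟙+≡ᵇ-bound t c y h = begin
    ∑ (λ k → 𝟙 (k + c ≡ᵇ y) * h k) (upTo (suc t))
      ≡⟨ ∑-upTo-𝟙+≡ᵇ (suc t) c y h ⟩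
    𝟙 (c ≤ᵇ y) * (𝟙 (y ∸ c <ᵇ suc t) * h (y ∸ c))
      ≡⟨ cong (λ b → 𝟙 (c ≤ᵇ y) * (𝟙 b * h (y ∸ c))) (<ᵇ-suc (y ∸ c) t) ⟩
    𝟙 (c ≤ᵇ y) * (𝟙 (y ∸ c ≤ᵇ t) * h (y ∸ c))
      ≡⟨ cong (𝟙 (c ≤ᵇ y) *_) (sym (ℕₚ.*-identityˡ _)) ⟩
    𝟙 (c ≤ᵇ y) * (1 * (𝟙 (y ∸ c ≤ᵇ t) * h (y ∸ c)))
      ≡⟨ cong (λ b → 𝟙 (c ≤ᵇ y) * (𝟙 b * (𝟙 (y ∸ c ≤ᵇ t) * h (y ∸ c))))
              (sym (trans (<ᵇ-suc (y ∸ c) y) (T-≡ .to (ℕₚ.≤⇒≤ᵇ (ℕₚ.m∸n≤m y c))))) ⟩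
    𝟙 (c ≤ᵇ y) * (𝟙 (y ∸ c <ᵇ suc y) * (𝟙 (y ∸ c ≤ᵇ t) * h (y ∸ c)))
      ≡⟨ sym (∑-upTo-𝟙+≡ᵇ (suc y) c y (λ k → 𝟙 (k ≤ᵇ t) * h k)) ⟩
    ∑ (λ k → 𝟙 (k + c ≡ᵇ y) * (𝟙 (k ≤ᵇ t) * h k)) (upTo (suc y)) ∎

  Peel-contentOK-cons : ∀ t b es {k y} → k ≤ y →
    𝟙 (k ≤ᵇ t) * Peel (t ∸ k) b (λ v → 𝟙 (contentOK 1 es ((y ∸ k) ∷ v))) ≡
    𝟙 (k + count 1 es ≡ᵇ y) * (𝟙 (k ≤ᵇ t) * Peel (t ∸ k) b (λ v → 𝟙 (contentOK 1 (map pred es) v)))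
  Peel-contentOK-cons t b es {k} {y} k≤y = begin
    𝟙 (k ≤ᵇ t) * Peel (t ∸ k) b (λ v → 𝟙 (contentOK 1 es ((y ∸ k) ∷ v)))
      ≡⟨ cong (𝟙 (k ≤ᵇ t) *_) (Peel-cong (t ∸ k) b (λ v _ →
           trans (cong (λ z → 𝟙 ((c ≡ᵇ y ∸ k) ∧ z)) (contentOK-pred v es)) (𝟙-∧ (c ≡ᵇ y ∸ k) _))) ⟩
    𝟙 (k ≤ᵇ t) * Peel (t ∸ k) b (λ v → 𝟙 (c ≡ᵇ y ∸ k) * Ok′ v)
      ≡⟨ cong (𝟙 (k ≤ᵇ t) *_) (Peel-*ˡ (t ∸ k) b (𝟙 (c ≡ᵇ y ∸ k)) Ok′) ⟩
    𝟙 (k ≤ᵇ t) * (𝟙 (c ≡ᵇ y ∸ k) * Peel (t ∸ k) b Ok′)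
      ≡⟨ x*yz≡y*xz (𝟙 (k ≤ᵇ t)) (𝟙 (c ≡ᵇ y ∸ k)) _ ⟩
    𝟙 (c ≡ᵇ y ∸ k) * (𝟙 (k ≤ᵇ t) * Peel (t ∸ k) b Ok′)
      ≡⟨ cong (λ z → 𝟙 z * (𝟙 (k ≤ᵇ t) * Peel (t ∸ k) b Ok′)) (∸≡ᵇ-as-+ c k≤y) ⟩
    𝟙 (k + c ≡ᵇ y) * (𝟙 (k ≤ᵇ t) * Peel (t ∸ k) b Ok′) ∎
    where
    c = count 1 es
    Ok′ : List ℕ → ℕ
    Ok′ v = 𝟙 (contentOK 1 (map pred es) v)

  -- A weakly increasing row r over 1, …, length b is determined by its content c, and
  -- r followed by es has content b iff es has content b - c.
  ∑-weakRows-content : ∀ t b es →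
    ∑ (λ r → 𝟙 (weakIncr r) * 𝟙 (contentOK 1 (r ++ es) b)) (rowsOf t (length b)) ≡
    Peel t b (λ v → 𝟙 (contentOK 1 es v))
  ∑-weakRows-content zero    []      es = refl
  ∑-weakRows-content (suc t) []      es = refl
  ∑-weakRows-content t       (y ∷ b) es = begin
    ∑ (λ r → 𝟙 (weakIncr r) * f r) (rowsOf t (suc (length b)))
      ≡⟨ ∑-weakRows-split (length b) t f ⟩
    ∑ (λ q → ∑ (λ r → 𝟙 (weakIncr r) * f (replicate q 1 ++ map (skip 0) r)) (rowsOf (t ∸ q) (length b)))
      (upTo (suc t))
      ≡⟨ ∑-cong ones-then-rest (upTo (suc t)) ⟩
    ∑ (λ q → 𝟙 (q + c ≡ᵇ y) * S q) (upTo (suc t))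
      ≡⟨ ∑-upTo-𝟙+≡ᵇ-bound t c y S ⟩
    ∑ (λ k → 𝟙 (k + c ≡ᵇ y) * (𝟙 (k ≤ᵇ t) * S k)) (upTo (suc y))
      ≡⟨ sym (∑-congᴬ (λ { k (s≤s k≤y) → Peel-contentOK-cons t b es k≤y }) (upTo-< (suc y))) ⟩
    Peel t (y ∷ b) (λ v → 𝟙 (contentOK 1 es v)) ∎
    where
    c = count 1 es
    f : List ℕ → ℕ
    f r = 𝟙 (contentOK 1 (r ++ es) (y ∷ b))
    S : ℕ → ℕ
    S q = Peel (t ∸ q) b (λ v → 𝟙 (contentOK 1 (map pred es) v))
    ones-then-rest : ∀ q →
      ∑ (λ r → 𝟙 (weakIncr r) * f (replicate q 1 ++ map (skip 0) r)) (rowsOf (t ∸ q) (length b)) ≡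
      𝟙 (q + c ≡ᵇ y) * S q
    ones-then-rest q = begin
      ∑ (λ r → 𝟙 (weakIncr r) * f (replicate q 1 ++ map (skip 0) r)) rows
        ≡⟨ ∑-cong (λ r → cong (𝟙 (weakIncr r) *_) (trans (cong 𝟙 (contentOK-ones-skip q r es y b))
                                                          (𝟙-∧ (q + c ≡ᵇ y) _))) rows ⟩
      ∑ (λ r → 𝟙 (weakIncr r) * (𝟙 (q + c ≡ᵇ y) * 𝟙 (contentOK 1 (r ++ map pred es) b))) rows
        ≡⟨ ∑-cong (λ r → x*yz≡y*xz (𝟙 (weakIncr r)) (𝟙 (q + c ≡ᵇ y)) _) rows ⟩
      ∑ (λ r → 𝟙 (q + c ≡ᵇ y) * (𝟙 (weakIncr r) * 𝟙 (contentOK 1 (r ++ map pred es) b))) rows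
        ≡⟨ ∑-*ˡ (𝟙 (q + c ≡ᵇ y)) _ rows ⟩
      𝟙 (q + c ≡ᵇ y) * ∑ (λ r → 𝟙 (weakIncr r) * 𝟙 (contentOK 1 (r ++ map pred es) b)) rows
        ≡⟨ cong (𝟙 (q + c ≡ᵇ y) *_) (∑-weakRows-content (t ∸ q) b (map pred es)) ⟩
      𝟙 (q + c ≡ᵇ y) * S q ∎
      where rows = rowsOf (t ∸ q) (length b)

  isTableau : List (List ℕ) → Bool
  isTableau τ = allB weakIncr τ ∧ strictIncr (firstColumn τ)

  completes : List ℕ → List ℕ → List (List ℕ) → Bool
  completes β r τ = allB weakIncr τ ∧ (strictIncr (firstColumn (r ∷ τ)) ∧ contentOK 1 (r ++ flatten τ) β)

  𝟙-isImmaculate-cons : ∀ β r τ → 𝟙 (isImmaculate β (r ∷ τ)) ≡ 𝟙 (weakIncr r) * 𝟙 (completes β r τ)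
  𝟙-isImmaculate-cons β r τ =
    trans (cong 𝟙 (Boolₚ.∧-assoc (weakIncr r) (allB weakIncr τ) _)) (𝟙-∧ (weakIncr r) _)

  𝟙-isImmaculate : ∀ β τ → 𝟙 (isImmaculate β τ) ≡ 𝟙 (isTableau τ) * 𝟙 (contentOK 1 (flatten τ) β)
  𝟙-isImmaculate β τ =
    trans (cong 𝟙 (sym (Boolₚ.∧-assoc (allB weakIncr τ) _ _))) (𝟙-∧ (isTableau τ) _)

  lowerRows-exceed : ∀ h τ → T (strictIncr (h ∷ firstColumn τ)) → T (allB weakIncr τ) →
                     All (h <_) (flatten τ)
  lowerRows-exceed h []            _ _ = []
  lowerRows-exceed h ([] ∷ τ)      s w = lowerRows-exceed h τ s w
  lowerRows-exceed h ((x ∷ r) ∷ τ) s w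
    with T-∧ {h <ᵇ x} .to s | T-∧ {weakIncr (x ∷ r)} .to w
  ... | h<ᵇx , s′ | wr , w′ = h<x ∷ Allₚ.++⁺
      (All.map (ℕₚ.<-≤-trans h<x) (weakIncr⇒All≥ x r wr))
      (All.map (ℕₚ.<-trans h<x) (lowerRows-exceed x τ s′ w′))
    where h<x = ℕₚ.<ᵇ⇒< h x h<ᵇx

  completes⇒avoids-one : ∀ β h rest τ → 0 < h → T (completes β (h ∷ rest) τ) → T (avoids 1 (flatten τ))
  completes⇒avoids-one β h rest τ h>0 c with T-∧ {allB weakIncr τ} .to c
  ... | w , column∧content = all>⇒avoids (flatten τ) (All.map (ℕₚ.≤-<-trans h>0)
    (lowerRows-exceed h τ (proj₁ (T-∧ {strictIncr (h ∷ firstColumn τ)} .to column∧content)) w))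

  ∑-completions-relabel : ∀ β h rest α m → 0 < h →
    ∑ (λ τ → 𝟙 (completes β (h ∷ rest) τ)) (fillings α (suc m)) ≡
    ∑ (λ τ → 𝟙 (completes β (h ∷ rest) (map (map (skip 0)) τ))) (fillings α m)
  ∑-completions-relabel β h rest α m h>0 = trans
    (∑-cong (λ τ → trans (sym (ℕₚ.*-identityʳ _))
      (𝟙-absorb _ (avoids 1 (flatten τ)) (completes⇒avoids-one β h rest τ h>0) 1)) (fillings α (suc m)))
    (trans (∑-fillings-avoiding z≤n α (λ τ → 𝟙 (completes β (h ∷ rest) τ) * 1))
           (∑-cong (λ τ → ℕₚ.*-identityʳ _) (fillings α m)))

  firstColumn-positive : ∀ τ → All Positive τ → Positive (firstColumn τ)
  firstColumn-positive []            []                = []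
  firstColumn-positive ([] ∷ τ)      (_ ∷ τ>0)         = firstColumn-positive τ τ>0
  firstColumn-positive ((x ∷ r) ∷ τ) ((x>0 ∷ _) ∷ τ>0) = x>0 ∷ firstColumn-positive τ τ>0

  strictIncr-one-skip : ∀ l → Positive l → strictIncr (1 ∷ map (skip 0) l) ≡ strictIncr l
  strictIncr-one-skip []          _        = refl
  strictIncr-one-skip (suc e ∷ l) _        = strictIncr-map (skip 0) (skip-<ᵇ 0) (suc e ∷ l)
  strictIncr-one-skip (zero ∷ l)  (() ∷ _)

  pred-skip0 : ∀ l → map pred (map (skip 0) l) ≡ l
  pred-skip0 []          = refl
  pred-skip0 (zero ∷ l)  = cong (0 ∷_) (pred-skip0 l)
  pred-skip0 (suc e ∷ l) = cong (suc e ∷_) (pred-skip0 l)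

  contentOK-ones-relabelled : ∀ q r es p b →
    contentOK 1 ((replicate q 1 ++ map (skip 0) r) ++ map (skip 0) es) (p ∷ b) ≡
    ((q ≡ᵇ p) ∧ contentOK 1 (r ++ es) b)
  contentOK-ones-relabelled q r es p b rewrite contentOK-ones-skip q r (map (skip 0) es) p b
    | count-skip-missed 0 es | ℕₚ.+-identityʳ q | pred-skip0 es = refl

  ∧-rearrange : ∀ a b c d → (a ∧ (b ∧ (c ∧ d))) ≡ (c ∧ ((a ∧ b) ∧ d))
  ∧-rearrange true  true  c d = refl
  ∧-rearrange true  false c d = sym (Boolₚ.∧-zeroʳ c)
  ∧-rearrange false b     c d = sym (Boolₚ.∧-zeroʳ c)

  completes-ones-skip : ∀ p b q r τ → All Positive τ →
    completes (p ∷ b) (replicate (suc q) 1 ++ map (skip 0) r) (map (map (skip 0)) τ) ≡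
    ((suc q ≡ᵇ p) ∧ (isTableau τ ∧ contentOK 1 (r ++ flatten τ) b))
  completes-ones-skip p b q r τ τ>0 = begin
    completes (p ∷ b) (replicate (suc q) 1 ++ map (skip 0) r) τ′
      ≡⟨ cong₂ _∧_ (allWeakIncr-map (skip 0) (skip-≤ᵇ 0) τ) (cong₂ _∧_
           (trans (cong (λ l → strictIncr (1 ∷ l)) (firstColumn-map (skip 0) τ))
                  (strictIncr-one-skip (firstColumn τ) (firstColumn-positive τ τ>0)))
           (trans (cong (λ es → contentOK 1 ((replicate (suc q) 1 ++ map (skip 0) r) ++ es) (p ∷ b))
                        (Listₚ.concat-map τ))
                  (contentOK-ones-relabelled (suc q) r (flatten τ) p b))) ⟩
    allB weakIncr τ ∧ (strictIncr (firstColumn τ) ∧ ((suc q ≡ᵇ p) ∧ contentOK 1 (r ++ flatten τ) b))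
      ≡⟨ ∧-rearrange (allB weakIncr τ) (strictIncr (firstColumn τ)) (suc q ≡ᵇ p) _ ⟩
    (suc q ≡ᵇ p) ∧ (isTableau τ ∧ contentOK 1 (r ++ flatten τ) b) ∎
    where τ′ = map (map (skip 0)) τ

  completes-without-ones : ∀ p b r τ →
    completes (suc p ∷ b) (map (skip 0) r) (map (map (skip 0)) τ) ≡ false
  completes-without-ones p b r τ
    rewrite Listₚ.concat-map {f = skip 0} τ | contentOK-ones-relabelled 0 r (flatten τ) (suc p) b
    = trans (cong (allB weakIncr (map (map (skip 0)) τ) ∧_) (Boolₚ.∧-zeroʳ _)) (Boolₚ.∧-zeroʳ _)

  ∑-completions : ∀ {A p} α b q r → 0 < A → 0 < p → Positive r → length r ≡ A ∸ q →
    ∑ (λ τ → 𝟙 (completes (p ∷ b) (replicate q 1 ++ map (skip 0) r) τ)) (fillings α (suc (length b))) ≡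
    𝟙 (q ≡ᵇ p) * ∑ (λ τ → 𝟙 (isTableau τ) * 𝟙 (contentOK 1 (r ++ flatten τ) b)) (fillings α (length b))
  ∑-completions {p = p} α b (suc q) r _ _ _ _ = begin
    ∑ (λ τ → 𝟙 (completes (p ∷ b) row τ)) (fillings α (suc m))
      ≡⟨ ∑-completions-relabel (p ∷ b) 1 _ α m (s≤s z≤n) ⟩
    ∑ (λ τ → 𝟙 (completes (p ∷ b) row (map (map (skip 0)) τ))) (fillings α m)
      ≡⟨ ∑-congᴬ (λ τ τ>0 → trans (cong 𝟙 (completes-ones-skip p b q r τ τ>0)) (𝟙-∧ (suc q ≡ᵇ p) _))
                 (fillings-positive α m) ⟩
    ∑ (λ τ → 𝟙 (suc q ≡ᵇ p) * 𝟙 (isTableau τ ∧ contentOK 1 (r ++ flatten τ) b)) (fillings α m)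
      ≡⟨ ∑-*ˡ (𝟙 (suc q ≡ᵇ p)) _ (fillings α m) ⟩
    𝟙 (suc q ≡ᵇ p) * ∑ (λ τ → 𝟙 (isTableau τ ∧ contentOK 1 (r ++ flatten τ) b)) (fillings α m)
      ≡⟨ cong (𝟙 (suc q ≡ᵇ p) *_) (∑-cong (λ τ → 𝟙-∧ (isTableau τ) _) (fillings α m)) ⟩
    𝟙 (suc q ≡ᵇ p) * ∑ (λ τ → 𝟙 (isTableau τ) * 𝟙 (contentOK 1 (r ++ flatten τ) b)) (fillings α m) ∎
    where m = length b
          row = replicate (suc q) 1 ++ map (skip 0) r
  ∑-completions {suc A} α b zero []      _ _ _            ()
  ∑-completions {p = suc p} α b zero (suc e ∷ r) _ _ _ _ = begin
    ∑ (λ τ → 𝟙 (completes (suc p ∷ b) row τ)) (fillings α (suc m))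
      ≡⟨ ∑-completions-relabel (suc p ∷ b) (suc (suc e)) _ α m (s≤s z≤n) ⟩
    ∑ (λ τ → 𝟙 (completes (suc p ∷ b) row (map (map (skip 0)) τ))) (fillings α m)
      ≡⟨ ∑-cong (λ τ → cong 𝟙 (completes-without-ones p b (suc e ∷ r) τ)) (fillings α m) ⟩
    ∑ (λ τ → 0) (fillings α m)
      ≡⟨ ∑-zero (fillings α m) ⟩
    0 ∎
    where m = length b
          row = map (skip 0) (suc e ∷ r)
  ∑-completions α b zero (zero ∷ r) _ _ (() ∷ _) _

  Peel-K : ∀ t α b →
    ∑ (λ r → 𝟙 (weakIncr r) *
             ∑ (λ τ → 𝟙 (isTableau τ) * 𝟙 (contentOK 1 (r ++ flatten τ) b)) (fillings α (length b)))
      (rowsOf t (length b))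
    ≡ Peel t b (K α)
  Peel-K t α b = begin
    ∑ (λ r → 𝟙 (weakIncr r) * ∑ (λ τ → W τ * C r τ) Τ) R
      ≡⟨ ∑-cong (λ r → trans (sym (∑-*ˡ (𝟙 (weakIncr r)) _ Τ))
                             (∑-cong (λ τ → x*yz≡y*xz (𝟙 (weakIncr r)) (W τ) (C r τ)) Τ)) R ⟩
    ∑ (λ r → ∑ (λ τ → W τ * (𝟙 (weakIncr r) * C r τ)) Τ) R
      ≡⟨ ∑-comm (λ r τ → W τ * (𝟙 (weakIncr r) * C r τ)) R Τ ⟩
    ∑ (λ τ → ∑ (λ r → W τ * (𝟙 (weakIncr r) * C r τ)) R) Τ
      ≡⟨ ∑-cong (λ τ → trans (∑-*ˡ (W τ) _ R) (cong (W τ *_) (∑-weakRows-content t b (flatten τ)))) Τ ⟩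
    ∑ (λ τ → W τ * Peel t b (λ v → 𝟙 (contentOK 1 (flatten τ) v))) Τ
      ≡⟨ ∑-cong (λ τ → sym (Peel-*ˡ t b (W τ) _)) Τ ⟩
    ∑ (λ τ → Peel t b (λ v → W τ * 𝟙 (contentOK 1 (flatten τ) v))) Τ
      ≡⟨ sym (Peel-∑ t b (λ τ v → W τ * 𝟙 (contentOK 1 (flatten τ) v)) Τ) ⟩
    Peel t b (λ v → ∑ (λ τ → W τ * 𝟙 (contentOK 1 (flatten τ) v)) Τ)
      ≡⟨ Peel-cong t b (λ v ∣v∣≡∣b∣ → sym (begin
           K α v
             ≡⟨ K-as-∑ α v ⟩
           ∑ (λ τ → 𝟙 (isImmaculate v τ)) (fillings α (length v))
             ≡⟨ cong (λ n → ∑ (λ τ → 𝟙 (isImmaculate v τ)) (fillings α n)) ∣v∣≡∣b∣ ⟩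
           ∑ (λ τ → 𝟙 (isImmaculate v τ)) Τ
             ≡⟨ ∑-cong (𝟙-isImmaculate v) Τ ⟩
           ∑ (λ τ → W τ * 𝟙 (contentOK 1 (flatten τ) v)) Τ ∎)) ⟩
    Peel t b (K α) ∎
    where
    R = rowsOf t (length b)
    Τ = fillings α (length b)
    W : List (List ℕ) → ℕ
    W τ = 𝟙 (isTableau τ)
    C : List ℕ → List (List ℕ) → ℕ
    C r τ = 𝟙 (contentOK 1 (r ++ flatten τ) b)

  K-firstRow : ∀ A α p b → 0 < A → 0 < p → K (A ∷ α) (p ∷ b) ≡ 𝟙 (p ≤ᵇ A) * Peel (A ∸ p) b (K α)
  K-firstRow A α p b A>0 p>0 = begin
    K (A ∷ α) β
      ≡⟨ K-as-∑ (A ∷ α) β ⟩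
    ∑ (λ τ → 𝟙 (isImmaculate β τ)) (fillings (A ∷ α) (suc m))
      ≡⟨ ∑-product _ (rowsOf A (suc m)) (fillings α (suc m)) ⟩
    ∑ (λ r → ∑ (λ τ → 𝟙 (isImmaculate β (r ∷ τ))) (fillings α (suc m))) (rowsOf A (suc m))
      ≡⟨ ∑-cong (λ r → trans (∑-cong (𝟙-isImmaculate-cons β r) (fillings α (suc m)))
                             (∑-*ˡ (𝟙 (weakIncr r)) _ (fillings α (suc m)))) (rowsOf A (suc m)) ⟩
    ∑ (λ r → 𝟙 (weakIncr r) * Completions r) (rowsOf A (suc m))
      ≡⟨ ∑-weakRows-split m A Completions ⟩
    ∑ (λ q → ∑ (λ r → 𝟙 (weakIncr r) * Completions (replicate q 1 ++ map (skip 0) r)) (rowsOf (A ∸ q) m))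
      (upTo (suc A))
      ≡⟨ ∑-cong (λ q → trans
           (∑-congᴬ (λ r (r>0 , ∣r∣) → trans
                       (cong (𝟙 (weakIncr r) *_) (∑-completions α b q r A>0 p>0 r>0 ∣r∣))
                       (x*yz≡y*xz (𝟙 (weakIncr r)) (𝟙 (q ≡ᵇ p)) _))
                    (rowsOf-shape (A ∸ q) m))
           (∑-*ˡ (𝟙 (q ≡ᵇ p)) _ (rowsOf (A ∸ q) m))) (upTo (suc A)) ⟩
    ∑ (λ q → 𝟙 (q ≡ᵇ p) * Pairs (A ∸ q)) (upTo (suc A))
      ≡⟨ ∑-upTo-𝟙≡ᵇ (suc A) p (λ q → Pairs (A ∸ q)) ⟩
    𝟙 (p <ᵇ suc A) * Pairs (A ∸ p)
      ≡⟨ cong₂ (λ b n → 𝟙 b * n) (<ᵇ-suc p A) (Peel-K (A ∸ p) α b) ⟩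
    𝟙 (p ≤ᵇ A) * Peel (A ∸ p) b (K α) ∎
    where
    β = p ∷ b
    m = length b
    Completions : List ℕ → ℕ
    Completions r = ∑ (λ τ → 𝟙 (completes β r τ)) (fillings α (suc m))
    Pairs : ℕ → ℕ
    Pairs t = ∑ (λ r → 𝟙 (weakIncr r) *
                       ∑ (λ τ → 𝟙 (isTableau τ) * 𝟙 (contentOK 1 (r ++ flatten τ) b)) (fillings α m))
                (rowsOf t m)

  ∑-≢0 : {A : Set} {P : A → Set} (f : A → ℕ) {xs : List A} →
         All P xs → ∑ f xs ≢ 0 → Σ A (λ x → P x × f x ≢ 0)
  ∑-≢0 f []                  ∑≢0 = ⊥-elim (∑≢0 refl)
  ∑-≢0 f {x ∷ xs} (px ∷ pxs) ∑≢0 with f x in fx≡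
  ... | zero  = ∑-≢0 f pxs ∑≢0
  ... | suc _ = x , px , λ fx≡0 → ℕₚ.1+n≢0 (trans (sym fx≡) fx≡0)

  𝟙*-≢0 : ∀ b n → 𝟙 b * n ≢ 0 → T b × n ≢ 0
  𝟙*-≢0 true  n 1*n≢0 = _ , λ n≡0 → 1*n≢0 (trans (ℕₚ.*-identityˡ n) n≡0)
  𝟙*-≢0 false n 0≢0   = ⊥-elim (0≢0 refl)

  Peel-support : ∀ t b F → Peel t b F ≢ 0 → Σ (List ℕ) λ b′ → F b′ ≢ 0 × sum b′ + t ≡ sum b
  Peel-support zero    []      F Peel≢0 = [] , proj₂ (𝟙*-≢0 true (F []) Peel≢0) , refl
  Peel-support (suc t) []      F Peel≢0 = ⊥-elim (Peel≢0 refl)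
  Peel-support t       (y ∷ b) F Peel≢0
    with ∑-≢0 (λ k → 𝟙 (k ≤ᵇ t) * Peel (t ∸ k) b (λ v → F ((y ∸ k) ∷ v))) (upTo-< (suc y)) Peel≢0
  ... | k , s≤s k≤y , term≢0 with 𝟙*-≢0 (k ≤ᵇ t) _ term≢0
  ... | k≤ᵇt , rest≢0 with Peel-support (t ∸ k) b (λ v → F ((y ∸ k) ∷ v)) rest≢0
  ... | b′ , Fb′≢0 , sums = (y ∸ k) ∷ b′ , Fb′≢0 , (begin
    (y ∸ k + sum b′) + t
      ≡⟨ cong ((y ∸ k + sum b′) +_) (sym (ℕₚ.m∸n+n≡m (ℕₚ.≤ᵇ⇒≤ k t k≤ᵇt))) ⟩
    (y ∸ k + sum b′) + (t ∸ k + k)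
      ≡⟨ +-interchange (y ∸ k) (sum b′) (t ∸ k) k ⟩
    (y ∸ k + k) + (sum b′ + (t ∸ k))
      ≡⟨ cong₂ _+_ (ℕₚ.m∸n+n≡m k≤y) sums ⟩
    y + sum b ∎)
    where
    +-interchange : ∀ a s b k → (a + s) + (b + k) ≡ (a + k) + (s + b)
    +-interchange = solve-∀

  isCompB-strip : ∀ v → T (isCompB (strip v))
  isCompB-strip []          = _
  isCompB-strip (zero ∷ v)  = isCompB-strip v
  isCompB-strip (suc k ∷ v) = isCompB-strip v

  sum-strip : ∀ v → sum (strip v) ≡ sum v
  sum-strip []          = refl
  sum-strip (zero ∷ v)  = sum-strip v
  sum-strip (suc k ∷ v) = cong (suc k +_) (sum-strip v)

  K-support : ∀ α β → Positive α → T (isCompB β) → K α β ≢ 0 → sum β ≡ sum α × T (β ≤ℓ α)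
  K-support []            []            _            _  _   = refl , _
  K-support []            (suc p ∷ β)   _            _  K≢0 = ⊥-elim (K≢0 refl)
  K-support (suc a ∷ α)   []            _            _  K≢0 = ⊥-elim (K≢0 refl)
  K-support (zero ∷ α)    β             (() ∷ _)     _  _
  K-support α             (zero ∷ β)    _            () _
  K-support (suc a ∷ α)   (suc p ∷ β)   (_ ∷ α>0)    β⊨ K≢0
    with 𝟙*-≢0 (suc p ≤ᵇ suc a) _
           (λ ≡0 → K≢0 (trans (K-firstRow (suc a) α (suc p) β (s≤s z≤n) (s≤s z≤n)) ≡0))
  ... | p≤ᵇa , Peel≢0 with Peel-support (suc a ∸ suc p) β (K α) Peel≢0
  ... | β′ , Kβ′≢0 , sums
    with K-support α (strip β′) α>0 (isCompB-strip β′) (λ ≡0 → Kβ′≢0 (trans (sym (K-strip α β′)) ≡0))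
  ... | sum-β′ , _ = size , lex
    where
    p≤a = ℕₚ.≤ᵇ⇒≤ (suc p) (suc a) p≤ᵇa
    size : suc p + sum β ≡ suc a + sum α
    size = begin
      suc p + sum β
        ≡⟨ cong (suc p +_) (sym sums) ⟩
      suc p + (sum β′ + (suc a ∸ suc p))
        ≡⟨ cong (λ z → suc p + (z + (suc a ∸ suc p))) (trans (sym (sum-strip β′)) sum-β′) ⟩
      suc p + (sum α + (suc a ∸ suc p))
        ≡⟨ +-rotate (suc p) (sum α) (suc a ∸ suc p) ⟩
      (suc a ∸ suc p + suc p) + sum α
        ≡⟨ cong (_+ sum α) (ℕₚ.m∸n+n≡m p≤a) ⟩
      suc a + sum α ∎
      where
      +-rotate : ∀ x y z → x + (y + z) ≡ (z + x) + y
      +-rotate = solve-∀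
    lex : T ((suc p <ᵇ suc a) ∨ ((suc p ≡ᵇ suc a) ∧ (β ≤ℓ α)))
    lex with suc p <ᵇ suc a in p<ᵇa
    ... | true  = _
    ... | false with ℕₚ.≤-antisym p≤a (ℕₚ.≮⇒≥ (λ p<a → subst T p<ᵇa (ℕₚ.<⇒<ᵇ p<a)))
    ... | refl rewrite ℕₚ.n∸n≡0 p | Peel-nothing β (K α) =
      T-∧ .from (ℕₚ.≡⇒≡ᵇ p p refl , proj₂ (K-support α β α>0 (proj₂ (T-∧ {1 ≤ᵇ suc p} .to β⊨)) Peel≢0))

  rhs-as-K : ∀ α β → Positive α → T (isCompB β) → rhs α β ≡ ℕ→ℚ (K α β)
  rhs-as-K α β α>0 β⊨ with K α β in K≡
  ... | zero = if-zero (isCompB β ∧ (sum β ≡ᵇ sum α) ∧ (β ≤ℓ α))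
    where
    if-zero : ∀ c → (if c then ℕ→ℚ 0 else 0ℚ) ≡ ℕ→ℚ 0
    if-zero true  = refl
    if-zero false = refl
  ... | suc n with K-support α β α>0 β⊨ (λ K≡0 → ℕₚ.1+n≢0 (trans (sym K≡) K≡0))
  ... | sum≡ , lex
    rewrite T-≡ .to β⊨ | T-≡ .to (ℕₚ.≡⇒≡ᵇ (sum β) (sum α) sum≡) | T-≡ .to lex = refl

  rhs-strip : ∀ α v → Positive α → rhs α (strip v) ≡ ℕ→ℚ (K α v)
  rhs-strip α v α>0 = trans (rhs-as-K α (strip v) α>0 (isCompB-strip v)) (cong ℕ→ℚ (K-strip α v))

module Duality where

  open import Data.Nat as ℕ using (_+_)
  open import Data.Rational using (mkℚ; -_; _/_) renaming (_+_ to _+ℚ_; _*_ to _*ℚ_)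
  import Data.Integer as ℤ
  import Data.Integer.Properties as ℤₚ
  import Data.Nat.Coprimality as Coprimality
  open ℚΣ
  open Immaculate using (Positive; K-firstRow; rhs-strip)
  open ≡-Reasoning

  private
    ℕ→ℚ-as-mkℚ : ∀ n → ℕ→ℚ n ≡ mkℚ (ℤ.+ n) 0 (Coprimality.sym (Coprimality.1-coprimeTo n))
    ℕ→ℚ-as-mkℚ n = ℚₚ.normalize-coprime (Coprimality.sym (Coprimality.1-coprimeTo n))

  ℕ→ℚ-+ : ∀ m n → ℕ→ℚ (m + n) ≡ ℕ→ℚ m +ℚ ℕ→ℚ n
  ℕ→ℚ-+ m n = sym (trans (cong₂ _+ℚ_ (ℕ→ℚ-as-mkℚ m) (ℕ→ℚ-as-mkℚ n))
    (cong (_/ 1) (cong₂ ℤ._+_ (ℤₚ.*-identityʳ (ℤ.+ m)) (ℤₚ.*-identityʳ (ℤ.+ n)))))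

  ℕ→ℚ-* : ∀ m n → ℕ→ℚ (m ℕ.* n) ≡ ℕ→ℚ m *ℚ ℕ→ℚ n
  ℕ→ℚ-* m n = sym (trans (cong₂ _*ℚ_ (ℕ→ℚ-as-mkℚ m) (ℕ→ℚ-as-mkℚ n))
    (cong (_/ 1) (sym (ℤₚ.pos-* m n))))

  ℕ→ℚ-∑ : {A : Set} (f : A → ℕ) (xs : List A) → ℕ→ℚ (ℕΣ.∑ f xs) ≡ ∑ (ℕ→ℚ ∘ f) xs
  ℕ→ℚ-∑ f []       = refl
  ℕ→ℚ-∑ f (x ∷ xs) = trans (ℕ→ℚ-+ (f x) _) (cong (ℕ→ℚ (f x) +ℚ_) (ℕ→ℚ-∑ f xs))

  ℕ→ℚ-𝟙* : ∀ b n → ℕ→ℚ (ℕΣ.𝟙 b ℕ.* n) ≡ 𝟙 b *ℚ ℕ→ℚ n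
  ℕ→ℚ-𝟙* true  n = ℕ→ℚ-* 1 n
  ℕ→ℚ-𝟙* false n = ℕ→ℚ-* 0 n

  ℕ→ℚ-Peel : ∀ t b F → ℕ→ℚ (ℕΣ.Peel t b F) ≡ Peel t b (ℕ→ℚ ∘ F)
  ℕ→ℚ-Peel t []      F = ℕ→ℚ-𝟙* (t ≡ᵇ 0) (F [])
  ℕ→ℚ-Peel t (y ∷ b) F = trans (ℕ→ℚ-∑ (λ k → ℕΣ.𝟙 (k ≤ᵇ t) ℕ.* ℕΣ.Peel (t ∸ k) b (G k)) (upTo (suc y)))
    (∑-cong (λ k → trans (ℕ→ℚ-𝟙* (k ≤ᵇ t) (ℕΣ.Peel (t ∸ k) b (G k)))
                         (cong (𝟙 (k ≤ᵇ t) *ℚ_) (ℕ→ℚ-Peel (t ∸ k) b (G k))))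
            (upTo (suc y)))
    where G = λ k v → F ((y ∸ k) ∷ v)

  K-firstRowℚ : ∀ A α p b → 0 < A → 0 < p →
    ℕ→ℚ (K (A ∷ α) (p ∷ b)) ≡ 𝟙 (p ≤ᵇ A) *ℚ Peel (A ∸ p) b (ℕ→ℚ ∘ K α)
  K-firstRowℚ A α p b A>0 p>0 = trans (cong ℕ→ℚ (K-firstRow A α p b A>0 p>0))
    (trans (ℕ→ℚ-𝟙* (p ≤ᵇ A) _) (cong (𝟙 (p ≤ᵇ A) *ℚ_) (ℕ→ℚ-Peel (A ∸ p) b (K α))))

  -- ⟪ X , H ⟫ pairs X with the functional given by H on words; on QSym, H = G ∘ strip.
  ⟪_,_⟫ : NSym → (Word → ℚ) → ℚ
  ⟪ X , H ⟫ = ∑ (λ cw → proj₁ cw *ℚ H (proj₂ cw)) X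

  pair-as-⟪⟫ : ∀ X G → pair X G ≡ ⟪ X , G ∘ strip ⟫
  pair-as-⟪⟫ []      G = refl
  pair-as-⟪⟫ ((c , w) ∷ X) G = cong (c *ℚ G (strip w) +ℚ_) (pair-as-⟪⟫ X G)

  ⟪⟫-*ˡ : ∀ X q f → ⟪ X , (λ w → q *ℚ f w) ⟫ ≡ q *ℚ ⟪ X , f ⟫
  ⟪⟫-*ˡ X q f = trans (∑-cong (λ cw → x*yz≡y*xz (proj₁ cw) q _) X) (∑-*ˡ q _ X)

  ⟪⟫-∑ : {A : Set} → ∀ X (g : A → Word → ℚ) is →
         ⟪ X , (λ w → ∑ (λ i → g i w) is) ⟫ ≡ ∑ (λ i → ⟪ X , g i ⟫) is
  ⟪⟫-∑ X g is = trans (∑-cong (λ cw → sym (∑-*ˡ (proj₁ cw) _ is)) X) (∑-comm _ X is)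

  ⟪⟫-cong : ∀ X {f g} → (∀ w → sum w ≤ deg X → f w ≡ g w) → ⟪ X , f ⟫ ≡ ⟪ X , g ⟫
  ⟪⟫-cong []            f≡g = refl
  ⟪⟫-cong ((c , w) ∷ X) f≡g = cong₂ _+ℚ_ (cong (c *ℚ_) (f≡g w (ℕₚ.m≤m+n (sum w) (deg X))))
    (⟪⟫-cong X (λ w′ w′≤ → f≡g w′ (ℕₚ.≤-trans w′≤ (ℕₚ.m≤n+m (deg X) (sum w)))))

  ⟪scale⟫ : ∀ q Y H → ⟪ scale q Y , H ⟫ ≡ q *ℚ ⟪ Y , H ⟫
  ⟪scale⟫ q Y H = trans (∑-map _ _ Y) (trans (∑-cong (λ { (c , w) → ℚₚ.*-assoc q c (H w) }) Y) (∑-*ˡ q _ Y))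

  ⟪Hmul⟫ : ∀ k Y H → ⟪ Hmul k Y , H ⟫ ≡ ⟪ Y , H ∘ (k ∷_) ⟫
  ⟪Hmul⟫ k Y H = trans (∑-map _ _ Y) (∑-cong (λ { (c , w) → refl }) Y)

  -- copΣ F H w = ⟨Δ(H_w), F ⊗ H⟩
  copΣ : QSym → (Word → ℚ) → Word → ℚ
  copΣ F H w = ∑ (λ ab → F (strip (proj₁ ab)) *ℚ H (proj₂ ab)) (cop w)

  ⟪perp⟫ : ∀ F X H → ⟪ perp F X , H ⟫ ≡ ⟪ X , copΣ F H ⟫
  ⟪perp⟫ F X H = trans (∑-concatMap _ _ X) (∑-cong (λ { (c , w) → begin
      ∑ _ (map _ (cop w))
        ≡⟨ ∑-map _ _ (cop w) ⟩
      ∑ (λ ab → (c *ℚ F (strip (proj₁ ab))) *ℚ H (proj₂ ab)) (cop w)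
        ≡⟨ ∑-cong (λ { (a , b) → ℚₚ.*-assoc c (F (strip a)) (H b) }) (cop w) ⟩
      ∑ (λ ab → c *ℚ (F (strip (proj₁ ab)) *ℚ H (proj₂ ab))) (cop w)
        ≡⟨ ∑-*ˡ c _ (cop w) ⟩
      c *ℚ copΣ F H w ∎ }) X)

  ⟪𝔹⟫ : ∀ m X H → ⟪ 𝔹 m X , H ⟫ ≡
    ⟪ X , (λ w → ∑ (λ i → signℚ i *ℚ copΣ (F1 i) (λ b → H ((m + i) ∷ b)) w) (upTo (suc (deg X)))) ⟫
  ⟪𝔹⟫ m X H = begin
    ⟪ 𝔹 m X , H ⟫
      ≡⟨ ∑-concatMap _ (λ i → scale (signℚ i) (Hmul (m + i) (perp (F1 i) X))) I ⟩
    ∑ (λ i → ⟪ scale (signℚ i) (Hmul (m + i) (perp (F1 i) X)) , H ⟫) I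
      ≡⟨ ∑-cong (λ i → trans (⟪scale⟫ (signℚ i) (Hmul (m + i) (perp (F1 i) X)) H) (cong (signℚ i *ℚ_)
           (trans (⟪Hmul⟫ (m + i) (perp (F1 i) X) H) (⟪perp⟫ (F1 i) X _)))) I ⟩
    ∑ (λ i → signℚ i *ℚ ⟪ X , copΣ (F1 i) (λ b → H ((m + i) ∷ b)) ⟫) I
      ≡⟨ sym (trans (⟪⟫-∑ X _ I) (∑-cong (λ i → ⟪⟫-*ˡ X (signℚ i) _) I)) ⟩
    ⟪ X , (λ w → ∑ (λ i → signℚ i *ℚ copΣ (F1 i) (λ b → H ((m + i) ∷ b)) w) I) ⟫ ∎
    where I = upTo (suc (deg X))

  isBin : Word → Bool
  isBin []                  = true
  isBin (zero ∷ a)          = isBin a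
  isBin (suc zero ∷ a)      = isBin a
  isBin (suc (suc _) ∷ a)   = false

  σ : Word → ℚ
  σ a = if isBin a then signℚ (sum a) else 0ℚ

  strip-==w-ones : ∀ a i → (strip a ==w replicate i 1) ≡ (isBin a ∧ (i ≡ᵇ sum a))
  strip-==w-ones []                  zero    = refl
  strip-==w-ones []                  (suc i) = refl
  strip-==w-ones (zero ∷ a)          i       = strip-==w-ones a i
  strip-==w-ones (suc zero ∷ a)      zero    = sym (Boolₚ.∧-zeroʳ (isBin a))
  strip-==w-ones (suc zero ∷ a)      (suc i) = strip-==w-ones a i
  strip-==w-ones (suc (suc k) ∷ a)   zero    = refl
  strip-==w-ones (suc (suc k) ∷ a)   (suc i) = refl

  ∑-signed-𝟙 : ∀ c {n} D (h : ℕ → ℚ) → n ≤ D →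
    ∑ (λ i → signℚ i *ℚ (𝟙 (c ∧ (i ≡ᵇ n)) *ℚ h i)) (upTo (suc D)) ≡ (if c then signℚ n else 0ℚ) *ℚ h n
  ∑-signed-𝟙 false {n} D h n≤D = begin
    ∑ (λ i → signℚ i *ℚ (0ℚ *ℚ h i)) (upTo (suc D))
      ≡⟨ ∑-cong (λ i → trans (cong (signℚ i *ℚ_) (ℚₚ.*-zeroˡ (h i))) (ℚₚ.*-zeroʳ (signℚ i)))
                (upTo (suc D)) ⟩
    ∑ (λ i → 0ℚ) (upTo (suc D))
      ≡⟨ ∑-zero (upTo (suc D)) ⟩
    0ℚ
      ≡⟨ sym (ℚₚ.*-zeroˡ (h n)) ⟩
    0ℚ *ℚ h n ∎
  ∑-signed-𝟙 true  {n} D h n≤D = begin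
    ∑ (λ i → signℚ i *ℚ (𝟙 (i ≡ᵇ n) *ℚ h i)) (upTo (suc D))
      ≡⟨ ∑-cong (λ i → x*yz≡y*xz (signℚ i) (𝟙 (i ≡ᵇ n)) (h i)) (upTo (suc D)) ⟩
    ∑ (λ i → 𝟙 (i ≡ᵇ n) *ℚ (signℚ i *ℚ h i)) (upTo (suc D))
      ≡⟨ ∑-upTo-𝟙≡ᵇ (suc D) n (λ i → signℚ i *ℚ h i) ⟩
    𝟙 (n <ᵇ suc D) *ℚ (signℚ n *ℚ h n)
      ≡⟨ cong (λ b → 𝟙 b *ℚ (signℚ n *ℚ h n)) (trans (<ᵇ-suc n D) (Boolₚ.T-≡ .to (ℕₚ.≤⇒≤ᵇ n≤D))) ⟩
    1ℚ *ℚ (signℚ n *ℚ h n)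
      ≡⟨ ℚₚ.*-identityˡ _ ⟩
    signℚ n *ℚ h n ∎

  ∑-signed-F1 : ∀ a D (h : ℕ → ℚ) → sum a ≤ D →
    ∑ (λ i → signℚ i *ℚ (F1 i (strip a) *ℚ h i)) (upTo (suc D)) ≡ σ a *ℚ h (sum a)
  ∑-signed-F1 a D h a≤D = trans
    (∑-cong (λ i → cong (λ b → signℚ i *ℚ (𝟙 b *ℚ h i)) (strip-==w-ones a i)) (upTo (suc D)))
    (∑-signed-𝟙 (isBin a) D h a≤D)

  cop-bound : ∀ w → All (λ ab → sum (proj₁ ab) ≤ sum w) (cop w)
  cop-bound []      = z≤n ∷ []
  cop-bound (x ∷ w) = Allₚ.concat⁺ (Allₚ.map⁺ (All.map (λ { (s≤s i≤x) →
    Allₚ.map⁺ (All.map (λ { {a , b} a≤w → ℕₚ.+-mono-≤ i≤x a≤w }) (cop-bound w)) }) (upTo-< (suc x))))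

  ∑-signed-copΣ : ∀ m w D (H : Word → ℚ) → sum w ≤ D →
    ∑ (λ i → signℚ i *ℚ copΣ (F1 i) (λ b → H ((m + i) ∷ b)) w) (upTo (suc D)) ≡
    ∑ (λ ab → σ (proj₁ ab) *ℚ H ((m + sum (proj₁ ab)) ∷ proj₂ ab)) (cop w)
  ∑-signed-copΣ m w D H w≤D = begin
    ∑ (λ i → signℚ i *ℚ copΣ (F1 i) (λ b → H ((m + i) ∷ b)) w) I
      ≡⟨ ∑-cong (λ i → sym (∑-*ˡ (signℚ i) _ (cop w))) I ⟩
    ∑ (λ i → ∑ (λ ab → signℚ i *ℚ (F1 i (strip (proj₁ ab)) *ℚ H ((m + i) ∷ proj₂ ab))) (cop w)) I
      ≡⟨ ∑-comm _ I (cop w) ⟩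
    ∑ (λ ab → ∑ (λ i → signℚ i *ℚ (F1 i (strip (proj₁ ab)) *ℚ H ((m + i) ∷ proj₂ ab))) I) (cop w)
      ≡⟨ ∑-congᴬ (λ { (a , b) a≤w → ∑-signed-F1 a D (λ i → H ((m + i) ∷ b)) (ℕₚ.≤-trans a≤w w≤D) })
                 (cop-bound w) ⟩
    ∑ (λ ab → σ (proj₁ ab) *ℚ H ((m + sum (proj₁ ab)) ∷ proj₂ ab)) (cop w) ∎
    where I = upTo (suc D)

  σ-one : ∀ a → σ (1 ∷ a) ≡ - σ a
  σ-one a with isBin a
  ... | true  = refl
  ... | false = refl

  ∑-cop-cons : ∀ x w (f : Word × Word → ℚ) → ∑ f (cop (x ∷ w)) ≡
    ∑ (λ j → ∑ (λ ab → f (j ∷ proj₁ ab , (x ∸ j) ∷ proj₂ ab)) (cop w)) (upTo (suc x))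
  ∑-cop-cons x w f =
    trans (∑-concatMap f (λ i → map (λ { (a , b) → (i ∷ a , (x ∸ i) ∷ b) }) (cop w)) (upTo (suc x)))
    (∑-cong (λ j → trans (∑-map f _ (cop w)) (∑-cong (λ { (a , b) → refl }) (cop w))) (upTo (suc x)))

  -- The terms of Peel s (x ∷ b) F that remove at least one cell from the first entry x.
  PeelTail : ℕ → ℕ → List ℕ → (List ℕ → ℚ) → ℚ
  PeelTail s x b F = ∑ (λ k → 𝟙 (suc k ≤ᵇ s) *ℚ Peel (s ∸ suc k) b (λ v → F ((x ∸ suc k) ∷ v))) (upTo x)

  Peel-cons-split : ∀ s x b F → Peel s (x ∷ b) F ≡ Peel s b (λ v → F (x ∷ v)) +ℚ PeelTail s x b F
  Peel-cons-split s x b F = begin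
    Peel s (x ∷ b) F
      ≡⟨ cong (∑ term) (upTo-suc x) ⟩
    1ℚ *ℚ Peel s b (λ v → F (x ∷ v)) +ℚ ∑ term (map suc (upTo x))
      ≡⟨ cong₂ _+ℚ_ (ℚₚ.*-identityˡ (Peel s b (λ v → F (x ∷ v)))) (∑-map term suc (upTo x)) ⟩
    Peel s b (λ v → F (x ∷ v)) +ℚ PeelTail s x b F ∎
    where term = λ k → 𝟙 (k ≤ᵇ s) *ℚ Peel (s ∸ k) b (λ v → F ((x ∸ k) ∷ v))

  PeelTail-shift : ∀ n t x b F →
    𝟙 (suc n ≤ᵇ t) *ℚ Peel (t ∸ suc n) (x ∷ b) F ≡ 𝟙 (n ≤ᵇ t) *ℚ PeelTail (t ∸ n) (suc x) b F
  PeelTail-shift n t x b F = begin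
    𝟙 (suc n ≤ᵇ t) *ℚ ∑ (λ k → 𝟙 (k ≤ᵇ t ∸ suc n) *ℚ P (t ∸ suc n ∸ k) k) (upTo (suc x))
      ≡⟨ sym (∑-*ˡ (𝟙 (suc n ≤ᵇ t)) _ (upTo (suc x))) ⟩
    ∑ (λ k → 𝟙 (suc n ≤ᵇ t) *ℚ (𝟙 (k ≤ᵇ t ∸ suc n) *ℚ P (t ∸ suc n ∸ k) k)) (upTo (suc x))
      ≡⟨ ∑-cong shift (upTo (suc x)) ⟩
    ∑ (λ k → 𝟙 (n ≤ᵇ t) *ℚ (𝟙 (suc k ≤ᵇ t ∸ n) *ℚ P (t ∸ n ∸ suc k) k)) (upTo (suc x))
      ≡⟨ ∑-*ˡ (𝟙 (n ≤ᵇ t)) _ (upTo (suc x)) ⟩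
    𝟙 (n ≤ᵇ t) *ℚ PeelTail (t ∸ n) (suc x) b F ∎
    where
    P : ℕ → ℕ → ℚ
    P s k = Peel s b (λ v → F ((x ∸ k) ∷ v))
    shift : ∀ k → 𝟙 (suc n ≤ᵇ t) *ℚ (𝟙 (k ≤ᵇ t ∸ suc n) *ℚ P (t ∸ suc n ∸ k) k) ≡
                  𝟙 (n ≤ᵇ t) *ℚ (𝟙 (suc k ≤ᵇ t ∸ n) *ℚ P (t ∸ n ∸ suc k) k)
    shift k = begin
      𝟙 (suc n ≤ᵇ t) *ℚ (𝟙 (k ≤ᵇ t ∸ suc n) *ℚ P (t ∸ suc n ∸ k) k)
        ≡⟨ sym (ℚₚ.*-assoc (𝟙 (suc n ≤ᵇ t)) (𝟙 (k ≤ᵇ t ∸ suc n)) _) ⟩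
      𝟙 (suc n ≤ᵇ t) *ℚ 𝟙 (k ≤ᵇ t ∸ suc n) *ℚ P (t ∸ suc n ∸ k) k
        ≡⟨ cong₂ _*ℚ_ indicators (cong (λ s → P s k) remaining) ⟩
      𝟙 (n ≤ᵇ t) *ℚ 𝟙 (suc k ≤ᵇ t ∸ n) *ℚ P (t ∸ n ∸ suc k) k
        ≡⟨ ℚₚ.*-assoc (𝟙 (n ≤ᵇ t)) (𝟙 (suc k ≤ᵇ t ∸ n)) _ ⟩
      𝟙 (n ≤ᵇ t) *ℚ (𝟙 (suc k ≤ᵇ t ∸ n) *ℚ P (t ∸ n ∸ suc k) k) ∎
      where
      indicators : 𝟙 (suc n ≤ᵇ t) *ℚ 𝟙 (k ≤ᵇ t ∸ suc n) ≡ 𝟙 (n ≤ᵇ t) *ℚ 𝟙 (suc k ≤ᵇ t ∸ n)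
      indicators = begin
        𝟙 (suc n ≤ᵇ t) *ℚ 𝟙 (k ≤ᵇ t ∸ suc n)   ≡⟨ sym (𝟙-∧ (suc n ≤ᵇ t) _) ⟩
        𝟙 ((suc n ≤ᵇ t) ∧ (k ≤ᵇ t ∸ suc n))    ≡⟨ cong 𝟙 (≤ᵇ-∸-split (suc n) k t) ⟩
        𝟙 (suc n + k ≤ᵇ t)                    ≡⟨ cong (λ z → 𝟙 (z ≤ᵇ t)) (sym (ℕₚ.+-suc n k)) ⟩
        𝟙 (n + suc k ≤ᵇ t)                    ≡⟨ cong 𝟙 (sym (≤ᵇ-∸-split n (suc k) t)) ⟩
        𝟙 ((n ≤ᵇ t) ∧ (suc k ≤ᵇ t ∸ n))        ≡⟨ 𝟙-∧ (n ≤ᵇ t) _ ⟩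
        𝟙 (n ≤ᵇ t) *ℚ 𝟙 (suc k ≤ᵇ t ∸ n)       ∎
      remaining : t ∸ suc n ∸ k ≡ t ∸ n ∸ suc k
      remaining = trans (ℕₚ.∸-+-assoc t (suc n) k)
        (trans (cong (t ∸_) (sym (ℕₚ.+-suc n k))) (sym (ℕₚ.∸-+-assoc t n (suc k))))

  peelWeight : ℕ → (List ℕ → ℚ) → Word × Word → ℚ
  peelWeight t F ab = σ (proj₁ ab) *ℚ (𝟙 (sum (proj₁ ab) ≤ᵇ t) *ℚ Peel (t ∸ sum (proj₁ ab)) (proj₂ ab) F)

  -- Only the letters j = 0, 1 of the first coproduct factor contribute, and the j = 1 term
  -- cancels exactly the terms of the j = 0 term that peel cells off the first entry.
  peelWeight-cons : ∀ t F a b x →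
    ∑ (λ j → peelWeight t F (j ∷ a , (x ∸ j) ∷ b)) (upTo (suc x)) ≡ peelWeight t (λ v → F (x ∷ v)) (a , b)
  peelWeight-cons t F a b zero = begin
    σ a *ℚ (I *ℚ Peel s (0 ∷ b) F) +ℚ 0ℚ
      ≡⟨ ℚₚ.+-identityʳ _ ⟩
    σ a *ℚ (I *ℚ Peel s (0 ∷ b) F)
      ≡⟨ cong (λ z → σ a *ℚ (I *ℚ z)) (trans (Peel-cons-split s 0 b F) (ℚₚ.+-identityʳ _)) ⟩
    σ a *ℚ (I *ℚ Peel s b (λ v → F (0 ∷ v))) ∎
    where s = t ∸ sum a
          I = 𝟙 (sum a ≤ᵇ t)
  peelWeight-cons t F a b (suc x) = begin
    ∑ term (upTo (suc (suc x)))
      ≡⟨ cong (∑ term) (upTo-suc (suc x)) ⟩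
    term 0 +ℚ ∑ term (map suc (upTo (suc x)))
      ≡⟨ cong (term 0 +ℚ_) (trans (∑-map term suc (upTo (suc x))) (cong (∑ (term ∘ suc)) (upTo-suc x))) ⟩
    term 0 +ℚ (term 1 +ℚ ∑ (term ∘ suc) (map suc (upTo x)))
      ≡⟨ cong (λ z → term 0 +ℚ (term 1 +ℚ z))
              (trans (∑-map (term ∘ suc) suc (upTo x)) (trans (∑-cong term-vanishes (upTo x)) (∑-zero (upTo x)))) ⟩
    term 0 +ℚ (term 1 +ℚ 0ℚ)
      ≡⟨ cong₂ _+ℚ_ term0 (trans (ℚₚ.+-identityʳ (term 1)) term1) ⟩
    (W +ℚ R) +ℚ - R
      ≡⟨ trans (ℚₚ.+-assoc W R (- R)) (trans (cong (W +ℚ_) (ℚₚ.+-inverseʳ R)) (ℚₚ.+-identityʳ W)) ⟩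
    W ∎
    where
    s = t ∸ sum a
    I = 𝟙 (sum a ≤ᵇ t)
    term : ℕ → ℚ
    term j = peelWeight t F (j ∷ a , (suc x ∸ j) ∷ b)
    W = σ a *ℚ (I *ℚ Peel s b (λ v → F (suc x ∷ v)))
    R = σ a *ℚ (I *ℚ PeelTail s (suc x) b F)
    term-vanishes : ∀ j → term (suc (suc j)) ≡ 0ℚ
    term-vanishes j = ℚₚ.*-zeroˡ (𝟙 (suc (suc j) + sum a ≤ᵇ t) *ℚ Peel (t ∸ (suc (suc j) + sum a)) ((x ∸ suc j) ∷ b) F)
    term0 : term 0 ≡ W +ℚ R
    term0 = begin
      σ a *ℚ (I *ℚ Peel s (suc x ∷ b) F)
        ≡⟨ cong (λ z → σ a *ℚ (I *ℚ z)) (Peel-cons-split s (suc x) b F) ⟩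
      σ a *ℚ (I *ℚ (Peel s b (λ v → F (suc x ∷ v)) +ℚ PeelTail s (suc x) b F))
        ≡⟨ trans (cong (σ a *ℚ_) (ℚₚ.*-distribˡ-+ I _ _)) (ℚₚ.*-distribˡ-+ (σ a) _ _) ⟩
      W +ℚ R ∎
    term1 : term 1 ≡ - R
    term1 = begin
      σ (1 ∷ a) *ℚ (𝟙 (suc (sum a) ≤ᵇ t) *ℚ Peel (t ∸ suc (sum a)) (x ∷ b) F)
        ≡⟨ cong₂ _*ℚ_ (σ-one a) (PeelTail-shift (sum a) t x b F) ⟩
      - σ a *ℚ (I *ℚ PeelTail s (suc x) b F)
        ≡⟨ sym (ℚₚ.neg-distribˡ-* (σ a) _) ⟩
      - R ∎

  ∑-cop-peelWeight : ∀ w t F → ∑ (peelWeight t F) (cop w) ≡ 𝟙 (t ≡ᵇ 0) *ℚ F w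
  ∑-cop-peelWeight []      t F = trans (ℚₚ.+-identityʳ _) (trans (ℚₚ.*-identityˡ _) (ℚₚ.*-identityˡ _))
  ∑-cop-peelWeight (x ∷ w) t F = begin
    ∑ (peelWeight t F) (cop (x ∷ w))
      ≡⟨ ∑-cop-cons x w (peelWeight t F) ⟩
    ∑ (λ j → ∑ (λ ab → peelWeight t F (j ∷ proj₁ ab , (x ∸ j) ∷ proj₂ ab)) (cop w)) (upTo (suc x))
      ≡⟨ ∑-comm _ (upTo (suc x)) (cop w) ⟩
    ∑ (λ ab → ∑ (λ j → peelWeight t F (j ∷ proj₁ ab , (x ∸ j) ∷ proj₂ ab)) (upTo (suc x))) (cop w)
      ≡⟨ ∑-cong (λ { (a , b) → peelWeight-cons t F a b x }) (cop w) ⟩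
    ∑ (peelWeight t (λ v → F (x ∷ v))) (cop w)
      ≡⟨ ∑-cop-peelWeight w t (λ v → F (x ∷ v)) ⟩
    𝟙 (t ≡ᵇ 0) *ℚ F (x ∷ w) ∎

  𝔹-coefficient : ∀ {A g} α w D → 0 < A → Positive α → 0 < g → sum w ≤ D →
    ∑ (λ i → signℚ i *ℚ copΣ (F1 i) (λ b → rhs (A ∷ α) (strip ((g + i) ∷ b))) w) (upTo (suc D)) ≡
    𝟙 (A ≡ᵇ g) *ℚ rhs α (strip w)
  𝔹-coefficient {A} {g} α w D A>0 α>0 g>0 w≤D = begin
    ∑ (λ i → signℚ i *ℚ copΣ (F1 i) (λ b → Φ ((g + i) ∷ b)) w) (upTo (suc D))
      ≡⟨ ∑-signed-copΣ g w D Φ w≤D ⟩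
    ∑ (λ ab → σ (proj₁ ab) *ℚ Φ ((g + sum (proj₁ ab)) ∷ proj₂ ab)) (cop w)
      ≡⟨ ∑-cong (λ { (a , b) → first-row a b }) (cop w) ⟩
    ∑ (λ ab → 𝟙 (g ≤ᵇ A) *ℚ peelWeight (A ∸ g) Kα ab) (cop w)
      ≡⟨ ∑-*ˡ (𝟙 (g ≤ᵇ A)) _ (cop w) ⟩
    𝟙 (g ≤ᵇ A) *ℚ ∑ (peelWeight (A ∸ g) Kα) (cop w)
      ≡⟨ cong (𝟙 (g ≤ᵇ A) *ℚ_) (∑-cop-peelWeight w (A ∸ g) Kα) ⟩
    𝟙 (g ≤ᵇ A) *ℚ (𝟙 (A ∸ g ≡ᵇ 0) *ℚ Kα w)
      ≡⟨ sym (ℚₚ.*-assoc (𝟙 (g ≤ᵇ A)) _ _) ⟩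
    𝟙 (g ≤ᵇ A) *ℚ 𝟙 (A ∸ g ≡ᵇ 0) *ℚ Kα w
      ≡⟨ cong₂ _*ℚ_ (trans (sym (𝟙-∧ (g ≤ᵇ A) _)) (cong 𝟙 (≤ᵇ-∸≡ᵇ0 g A)))
                    (sym (rhs-strip α w α>0)) ⟩
    𝟙 (A ≡ᵇ g) *ℚ rhs α (strip w) ∎
    where
    Φ : Word → ℚ
    Φ v = rhs (A ∷ α) (strip v)
    Kα : List ℕ → ℚ
    Kα = ℕ→ℚ ∘ K α
    first-row : ∀ a b → σ a *ℚ Φ ((g + sum a) ∷ b) ≡ 𝟙 (g ≤ᵇ A) *ℚ peelWeight (A ∸ g) Kα (a , b)
    first-row a b = begin
      σ a *ℚ Φ ((g + sum a) ∷ b)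
        ≡⟨ cong (σ a *ℚ_) (trans (rhs-strip (A ∷ α) ((g + sum a) ∷ b) (A>0 ∷ α>0))
             (K-firstRowℚ A α (g + sum a) b A>0 (ℕₚ.<-≤-trans g>0 (ℕₚ.m≤m+n g (sum a))))) ⟩
      σ a *ℚ (𝟙 (g + sum a ≤ᵇ A) *ℚ Peel (A ∸ (g + sum a)) b Kα)
        ≡⟨ cong₂ (λ z s → σ a *ℚ (z *ℚ Peel s b Kα))
             (trans (cong 𝟙 (sym (≤ᵇ-∸-split g (sum a) A))) (𝟙-∧ (g ≤ᵇ A) _))
             (sym (ℕₚ.∸-+-assoc A g (sum a))) ⟩
      σ a *ℚ ((𝟙 (g ≤ᵇ A) *ℚ 𝟙 (sum a ≤ᵇ A ∸ g)) *ℚ Peel (A ∸ g ∸ sum a) b Kα)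
        ≡⟨ cong (σ a *ℚ_) (ℚₚ.*-assoc (𝟙 (g ≤ᵇ A)) _ _) ⟩
      σ a *ℚ (𝟙 (g ≤ᵇ A) *ℚ (𝟙 (sum a ≤ᵇ A ∸ g) *ℚ Peel (A ∸ g ∸ sum a) b Kα))
        ≡⟨ x*yz≡y*xz (σ a) (𝟙 (g ≤ᵇ A)) _ ⟩
      𝟙 (g ≤ᵇ A) *ℚ peelWeight (A ∸ g) Kα (a , b) ∎

  𝔖-dual : ∀ γ → Positive γ → ∀ α → Positive α → sum α ≡ sum γ →
           ⟪ 𝔖 γ , rhs α ∘ strip ⟫ ≡ δ α γ
  𝔖-dual []      _           []      _           _    = refl
  𝔖-dual []      _           (a ∷ α) (a>0 ∷ _)   sum≡ =
    ⊥-elim (ℕₚ.<-irrefl (sym sum≡) (ℕₚ.<-≤-trans a>0 (ℕₚ.m≤m+n a (sum α))))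
  𝔖-dual (g ∷ γ) (g>0 ∷ _)   []      _           sum≡ =
    ⊥-elim (ℕₚ.<-irrefl sum≡ (ℕₚ.<-≤-trans g>0 (ℕₚ.m≤m+n g (sum γ))))
  𝔖-dual (g ∷ γ) (g>0 ∷ γ>0) (A ∷ α) (A>0 ∷ α>0) sum≡ = begin
    ⟪ 𝔹 g (𝔖 γ) , Φ ⟫
      ≡⟨ ⟪𝔹⟫ g (𝔖 γ) Φ ⟩
    ⟪ 𝔖 γ , (λ w → ∑ (λ i → signℚ i *ℚ copΣ (F1 i) (λ b → Φ ((g + i) ∷ b)) w)
                     (upTo (suc (deg (𝔖 γ))))) ⟫
      ≡⟨ ⟪⟫-cong (𝔖 γ) (λ w w≤ → 𝔹-coefficient α w (deg (𝔖 γ)) A>0 α>0 g>0 w≤) ⟩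
    ⟪ 𝔖 γ , (λ w → 𝟙 (A ≡ᵇ g) *ℚ rhs α (strip w)) ⟫
      ≡⟨ ⟪⟫-*ˡ (𝔖 γ) (𝟙 (A ≡ᵇ g)) (rhs α ∘ strip) ⟩
    𝟙 (A ≡ᵇ g) *ℚ ⟪ 𝔖 γ , rhs α ∘ strip ⟫
      ≡⟨ same-head ⟩
    δ (A ∷ α) (g ∷ γ) ∎
    where
    Φ : Word → ℚ
    Φ v = rhs (A ∷ α) (strip v)
    same-head : 𝟙 (A ≡ᵇ g) *ℚ ⟪ 𝔖 γ , rhs α ∘ strip ⟫ ≡ δ (A ∷ α) (g ∷ γ)
    same-head with A ≡ᵇ g in A≡ᵇg
    ... | false = ℚₚ.*-zeroˡ ⟪ 𝔖 γ , rhs α ∘ strip ⟫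
    ... | true with ℕₚ.≡ᵇ⇒≡ A g (subst T (sym A≡ᵇg) _)
    ... | refl = trans (ℚₚ.*-identityˡ ⟪ 𝔖 γ , rhs α ∘ strip ⟫)
                       (𝔖-dual γ γ>0 α α>0 (ℕₚ.+-cancelˡ-≡ A _ _ sum≡))

proposition3p36 : (n : ℕ) (α γ : List ℕ) → IsComposition n α → IsComposition n γ →
    pair (𝔖 γ) (rhs α) ≡ δ α γ
proposition3p36 n α γ (α>0 , ∣α∣≡n) (γ>0 , ∣γ∣≡n) =
  trans (pair-as-⟪⟫ (𝔖 γ) (rhs α)) (𝔖-dual γ γ>0 α α>0 (trans ∣α∣≡n (sym ∣γ∣≡n)))
  where open Duality using (pair-as-⟪⟫; 𝔖-dual)
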